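{- Let $f:\{0,1\}^n\to\{0,1\}$ and let $M\subseteq[n]$, $|M|=d\ge1$, be such that $\prod_{i\in M}x_i$ has non-zero coefficient in the multilinear polynomial of $f$. Then \[ \sum_{i\in M}\frac{\delta_i(f)}{2^{\mathrm{sens}_i(f)}} \le \sum_{k=2}^{\lfloor\sqrt d+1\rfloor}\frac{2k-3}{2^k}+\frac{d-\lfloor\sqrt d\rfloor^2}{2^{\lfloor\sqrt d+2\rfloor}} < 1.5. \]
   Context: $x^i$ is $x$ with bit $i$ flipped; $\delta_i(f)=1$ if $f(x)\ne f(x^i)$ for some $x$, else $0$. $s_x(f)$ is the number of $j$ with $f(x)\ne f(x^j)$; $\mathrm{sens}_i(f):=\max_{x:f(x)\ne f(x^i)}(s_x(f)+s_{x^i}(f))$, and $0$ if no such $x$ exists. -}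

module Defs where

open import Data.Bool using (Bool; true; false; not; if_then_else_; _∨_; _xor_)
open import Data.Nat as ℕ using (ℕ; zero; suc; _∸_; _≤ᵇ_)
open import Data.Integer as ℤ using (ℤ; +_)
open import Data.Rational as ℚ using (ℚ; 0ℚ; 1ℚ; ½)
open import Data.Fin using (Fin)
open import Data.Vec using (Vec; []; _∷_; lookup; updateAt; allFin; foldr′; map)

-- Boolean inputs / subsets of [n] are bit vectors of length n.
Input : ℕ → Set
Input n = Vec Bool n

BoolFun : ℕ → Set
BoolFun n = Input n → Bool

flipBit : ∀ {n} → Fin n → Input n → Input n
flipBit i x = updateAt x i not

b2ℤ : Bool → ℤ
b2ℤ true = + 1
b2ℤ false = + 0

sumAll : ∀ {n} → (Input n → ℤ) → ℤ
sumAll {zero} g = g []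
sumAll {suc n} g = sumAll (λ v → g (false ∷ v)) ℤ.+ sumAll (λ v → g (true ∷ v))

maxAll : ∀ {n} → (Input n → ℕ) → ℕ
maxAll {zero} g = g []
maxAll {suc n} g = maxAll (λ v → g (false ∷ v)) ℕ.⊔ maxAll (λ v → g (true ∷ v))

anyAll : ∀ {n} → (Input n → Bool) → Bool
anyAll {zero} g = g []
anyAll {suc n} g = anyAll (λ v → g (false ∷ v)) ∨ anyAll (λ v → g (true ∷ v))

monomial : ∀ {n} → Vec Bool n → Input n → ℤ
monomial [] [] = + 1
monomial (false ∷ S) (_ ∷ x) = monomial S x
monomial (true ∷ S) (b ∷ x) = b2ℤ b ℤ.* monomial S x

-- c : coefficients (indexed by subsets S ⊆ [n]) of a multilinear
-- polynomial  Σ_S c_S ∏_{i∈S} x_i ; it represents f if it agrees with f on {0,1}^n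
Represents : ∀ {n} → (Vec Bool n → ℤ) → BoolFun n → Set
Represents c f = ∀ x → sumAll (λ S → c S ℤ.* monomial S x) ≡ b2ℤ (f x)
  where open import Relation.Binary.PropositionalEquality using (_≡_)

differs : ∀ {n} → BoolFun n → Fin n → Input n → Bool
differs f i x = f x xor f (flipBit i x)

sensAt : ∀ {n} → BoolFun n → Input n → ℕ
sensAt {n} f x = foldr′ (λ j acc → (if differs f j x then 1 else 0) ℕ.+ acc) 0 (allFin n)

δ : ∀ {n} → BoolFun n → Fin n → ℕ
δ f i = if anyAll (differs f i) then 1 else 0

-- sens_i(f) = max_{x : f(x) ≠ f(x^i)} (s_x(f) + s_{x^i}(f)), and 0 if no such x
sens : ∀ {n} → BoolFun n → Fin n → ℕ
sens f i = maxAll (λ x → if differs f i x then sensAt f x ℕ.+ sensAt f (flipBit i x) else 0)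

inv2^ : ℕ → ℚ
inv2^ zero = 1ℚ
inv2^ (suc k) = ½ ℚ.* inv2^ k

_/2^_ : ℕ → ℕ → ℚ
a /2^ k = (+ a ℚ./ 1) ℚ.* inv2^ k

isqrt : ℕ → ℕ
isqrt zero = zero
isqrt (suc m) = let r = isqrt m in
  if (suc r ℕ.* suc r) ≤ᵇ suc m then suc r else r

-- Σ_{k = a}^{b} g k   (empty if b < a)
sumFromTo : ℕ → ℕ → (ℕ → ℚ) → ℚ
sumFromTo a zero g = if a ≤ᵇ 0 then g 0 else 0ℚ
sumFromTo a (suc b) g = sumFromTo a b g ℚ.+ (if a ≤ᵇ suc b then g (suc b) else 0ℚ)

sumOver : ∀ {n} → Vec Bool n → (Fin n → ℚ) → ℚ
sumOver {n} M g = foldr′ (λ i acc → (if lookup M i then g i else 0ℚ) ℚ.+ acc) 0ℚ (allFin n)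

lhs : ∀ {n} → BoolFun n → Vec Bool n → ℚ
lhs f M = sumOver M (λ i → δ f i /2^ sens f i)

bound : ℕ → ℚ
bound d = sumFromTo 2 (suc (isqrt d)) (λ k → (2 ℕ.* k ∸ 3) /2^ k)
          ℚ.+ ((d ∸ isqrt d ℕ.* isqrt d) /2^ (2 ℕ.+ isqrt d))

-- The coefficient of ∏_{i∈M} x_i is the iterated finite difference ∂_M f at 0. If it is nonzero,
-- then for every T ⊆ M some restriction of f to a T-subcube has full degree, so by Huang's theorem
-- it has a point of sensitivity at least √|T|; Huang's signed adjacency matrix satisfies A² = |T|·I,
-- and a counting of dimensions produces a nonzero vector supported on a majority set H whose image
-- under A vanishes off H. The neighbour across the sensitive coordinate i is sensitive as well, so
-- sens_i(f) > √|T|. With T = {i ∈ M : δ_i(f) = 1, sens_i(f) ≤ k} this shows that at most (k−1)²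
-- of the exponents sens_i are ≤ k. Sorting them decreasingly, the exponent followed by d′ others
-- is at least 2 + ⌊√d′⌋, so the sum is at most Σ_{j<d} 2^-(2+⌊√j⌋), which equals the stated bound;
-- the closed form Σ_{k=2}^{m+1} (2k−3)/2^k = 3/2 − (2m+3)/2^{m+1} shows that it is below 3/2.

module Submission where

open import Defs
open import Data.Bool using (Bool)
open import Data.Nat using (ℕ; _≤_)
open import Data.Integer using (ℤ; +_)
open import Data.Rational using (ℚ; _/_) renaming (_≤_ to _≤ℚ_; _<_ to _<ℚ_)
open import Data.Vec using (Vec)
open import Data.Fin.Subset using (∣_∣)
open import Data.Product using (Σ; _×_)
open import Relation.Binary.PropositionalEquality using (_≢_)

open import Data.Bool using (true; false; not; if_then_else_; _∧_; _xor_; T)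
import Data.Bool.Properties as Boolₚ
open import Data.Nat as ℕ using (zero; suc; _<_; z≤n; s≤s; _∸_)
import Data.Nat.Properties as ℕₚ
import Data.Nat.Tactic.RingSolver as NatSolver
import Data.Integer as ℤ
import Data.Integer.Properties as ℤₚ
open import Data.Integer.Tactic.RingSolver using (solve-∀)
open import Data.Rational as ℚ using (0ℚ; 1ℚ; ½)
import Data.Rational.Properties as ℚₚ
import Data.Rational.Unnormalised as ℚᵘ
import Data.Rational.Unnormalised.Properties as ℚᵘₚ
open import Data.Fin using (Fin; zero; suc)
open import Data.Fin.Subset using (Subset; _⊆_; _∈_; ⊤)
open import Data.Fin.Subset.Properties using (drop-∷-⊆)
open import Data.Vec using ([]; _∷_; here; there; lookup; tabulate; allFin; foldr′; replicate; map)
import Data.Vec.Properties as Vecₚ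
open import Data.List as List using (List; []; _∷_; _++_; length)
import Data.List.Properties as Listₚ
open import Data.List.Membership.Propositional using () renaming (_∈_ to _∈ₗ_; _∉_ to _∉ₗ_)
open import Data.List.Membership.Propositional.Properties using (∈-map⁺; ∈-map⁻; ∈-++⁺ˡ; ∈-++⁺ʳ; ∈-++⁻)
open import Data.List.Relation.Unary.Any using () renaming (here to hereₗ; there to thereₗ)
open import Data.List.Relation.Unary.All using ([]; _∷_)
import Data.List.Relation.Unary.All as All
import Data.List.Relation.Unary.All.Properties as Allₚ
open import Data.List.Relation.Unary.AllPairs using ([]; _∷_)
open import Data.List.Relation.Unary.Unique.Propositional using (Unique)
import Data.List.Relation.Unary.Unique.Propositional.Properties as Uniqueₚ
open import Data.List.Relation.Unary.Linked as Linked using (Linked)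
open import Data.List.Relation.Unary.Linked.Properties using (Linked⇒All)
open import Data.List.Relation.Binary.Permutation.Propositional using (_↭_; ↭-sym; ↭⇒↭ₛ)
import Data.List.Relation.Binary.Permutation.Propositional.Properties as Permₚ
import Data.List.Relation.Binary.Permutation.Setoid.Properties ℚₚ.≡-setoid as Permₛₚ
open import Relation.Binary.Properties.DecTotalOrder ℕₚ.≤-decTotalOrder using (≥-decTotalOrder)
import Data.List.Sort ≥-decTotalOrder as Descending
open import Data.Product using (_,_; proj₁; proj₂; ∃; ∃₂)
open import Data.Sum using (_⊎_; inj₁; inj₂)
open import Data.Empty using (⊥-elim)
open import Function using (_∘_)
open import Relation.Binary.Definitions using (DecidableEquality; tri<; tri≈; tri>)
open import Relation.Nullary using (¬_; yes; no)
open import Relation.Nullary.Decidable using (does; dec-true; dec-false; T?)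
open import Relation.Binary.PropositionalEquality
  using (_≡_; refl; sym; trans; cong; cong₂; subst; subst₂; module ≡-Reasoning)

⟦_⟧ : Bool → ℕ
⟦ b ⟧ = if b then 1 else 0

foldr′-tabulate : ∀ {n} {A B : Set} (c : A → B → B) (z : B) (g : Fin n → A) →
                  foldr′ c z (tabulate g) ≡ foldr′ (c ∘ g) z (allFin n)
foldr′-tabulate {zero}  c z g = refl
foldr′-tabulate {suc n} c z g = cong (c (g zero))
  (trans (foldr′-tabulate c z (g ∘ suc)) (sym (foldr′-tabulate (c ∘ g) z suc)))

foldr′-allFin-suc : ∀ {n} {B : Set} (c : Fin (suc n) → B → B) (z : B) →
                    foldr′ c z (allFin (suc n)) ≡ c zero (foldr′ (c ∘ suc) z (allFin n))
foldr′-allFin-suc c z = cong (c zero) (foldr′-tabulate c z suc)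

flipBit-involutive : ∀ {n} (i : Fin n) (x : Input n) → flipBit i (flipBit i x) ≡ x
flipBit-involutive zero    (b ∷ x) = cong (_∷ x) (Boolₚ.not-involutive b)
flipBit-involutive (suc i) (b ∷ x) = cong (b ∷_) (flipBit-involutive i x)

differs-flipBit : ∀ {n} (f : BoolFun n) i x → differs f i (flipBit i x) ≡ differs f i x
differs-flipBit f i x = trans (cong (λ y → f (flipBit i x) xor f y) (flipBit-involutive i x))
                              (Boolₚ.xor-comm (f (flipBit i x)) (f x))

sensAt-∷ : ∀ {n} (f : BoolFun (suc n)) b x →
           sensAt f (b ∷ x) ≡ ⟦ f (b ∷ x) xor f (not b ∷ x) ⟧ ℕ.+ sensAt (λ y → f (b ∷ y)) x
sensAt-∷ f b x = foldr′-allFin-suc (λ j acc → ⟦ differs f j (b ∷ x) ⟧ ℕ.+ acc) 0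

differs⇒0<sensAt : ∀ {n} (f : BoolFun n) j x → differs f j x ≡ true → 0 < sensAt f x
differs⇒0<sensAt f zero (b ∷ x) d rewrite sensAt-∷ f b x | d = s≤s z≤n
differs⇒0<sensAt f (suc j) (b ∷ x) d rewrite sensAt-∷ f b x =
  ℕₚ.≤-trans (differs⇒0<sensAt (λ y → f (b ∷ y)) j x d) (ℕₚ.m≤n+m _ _)

0<sensAt⇒differs : ∀ {n} (f : BoolFun n) x → 0 < sensAt f x → ∃ λ j → differs f j x ≡ true
0<sensAt⇒differs {zero} f [] ()
0<sensAt⇒differs {suc n} f (b ∷ x) pos rewrite sensAt-∷ f b x
  with f (b ∷ x) xor f (not b ∷ x) in d
... | true  = zero , d
... | false = let j , dj = 0<sensAt⇒differs (λ y → f (b ∷ y)) x pos in suc j , dj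

maxAll-≥ : ∀ {n} (φ : Input n → ℕ) x → φ x ≤ maxAll φ
maxAll-≥ φ [] = ℕₚ.≤-refl
maxAll-≥ φ (false ∷ x) = ℕₚ.≤-trans (maxAll-≥ (λ v → φ (false ∷ v)) x) (ℕₚ.m≤m⊔n _ _)
maxAll-≥ φ (true ∷ x)  = ℕₚ.≤-trans (maxAll-≥ (λ v → φ (true ∷ v)) x) (ℕₚ.m≤n⊔m _ _)

sensAt+sensAt≤sens : ∀ {n} (f : BoolFun n) i x → differs f i x ≡ true →
                     sensAt f x ℕ.+ sensAt f (flipBit i x) ≤ sens f i
sensAt+sensAt≤sens f i x d =
  subst (_≤ sens f i) (cong (λ b → if b then sensAt f x ℕ.+ sensAt f (flipBit i x) else 0) d)
        (maxAll-≥ (λ y → if differs f i y then sensAt f y ℕ.+ sensAt f (flipBit i y) else 0) x)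

-- Derivatives and coefficients

𝟎 : ∀ {n} → Input n
𝟎 = replicate _ false

-- The iterated finite difference of G in the directions S; the other coordinates are read from w.
∂ : ∀ {n} → Subset n → (Input n → ℤ) → Input n → ℤ
∂ []          G []      = G []
∂ (true ∷ S)  G (_ ∷ w) = ∂ S (λ y → G (true ∷ y)) w ℤ.- ∂ S (λ y → G (false ∷ y)) w
∂ (false ∷ S) G (b ∷ w) = ∂ S (λ y → G (b ∷ y)) w

∂-cong : ∀ {n} (S : Subset n) {G K : Input n → ℤ} → (∀ y → G y ≡ K y) → ∀ w → ∂ S G w ≡ ∂ S K w
∂-cong []          e []      = e []
∂-cong (true ∷ S)  e (_ ∷ w) = cong₂ ℤ._-_ (∂-cong S (e ∘ (true ∷_)) w) (∂-cong S (e ∘ (false ∷_)) w)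
∂-cong (false ∷ S) e (b ∷ w) = ∂-cong S (e ∘ (b ∷_)) w

∂-difference : ∀ {n} (S : Subset n) (G K : Input n → ℤ) w → ∂ S (λ y → G y ℤ.- K y) w ≡ ∂ S G w ℤ.- ∂ S K w
∂-difference []          G K []      = refl
∂-difference (true ∷ S)  G K (_ ∷ w) = trans
  (cong₂ ℤ._-_ (∂-difference S (λ y → G (true ∷ y)) (λ y → K (true ∷ y)) w)
               (∂-difference S (λ y → G (false ∷ y)) (λ y → K (false ∷ y)) w))
  (interchange (∂ S (λ y → G (true ∷ y)) w) (∂ S (λ y → K (true ∷ y)) w)
               (∂ S (λ y → G (false ∷ y)) w) (∂ S (λ y → K (false ∷ y)) w))
  where
  interchange : ∀ a b c d → (a ℤ.- b) ℤ.- (c ℤ.- d) ≡ (a ℤ.- c) ℤ.- (b ℤ.- d)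
  interchange = solve-∀
∂-difference (false ∷ S) G K (b ∷ w) = ∂-difference S (λ y → G (b ∷ y)) (λ y → K (b ∷ y)) w

sumAll-cong : ∀ {n} {G K : Input n → ℤ} → (∀ y → G y ≡ K y) → sumAll G ≡ sumAll K
sumAll-cong {zero}  e = e []
sumAll-cong {suc n} e = cong₂ ℤ._+_ (sumAll-cong (e ∘ (false ∷_))) (sumAll-cong (e ∘ (true ∷_)))

sumAll-0 : ∀ {n} {G : Input n → ℤ} → (∀ y → G y ≡ + 0) → sumAll G ≡ + 0
sumAll-0 {zero}  e = e []
sumAll-0 {suc n} e = cong₂ ℤ._+_ (sumAll-0 (e ∘ (false ∷_))) (sumAll-0 (e ∘ (true ∷_)))

evalPoly : ∀ {n} → (Subset n → ℤ) → Input n → ℤ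
evalPoly c x = sumAll (λ S → c S ℤ.* monomial S x)

evalPoly-false : ∀ {n} (c : Subset (suc n) → ℤ) y →
                 evalPoly c (false ∷ y) ≡ evalPoly (λ S → c (false ∷ S)) y
evalPoly-false c y = trans
  (cong (λ u → evalPoly (λ S → c (false ∷ S)) y ℤ.+ u)
        (sumAll-0 (λ S → trans (cong (c (true ∷ S) ℤ.*_) (ℤₚ.*-zeroˡ (monomial S y)))
                               (ℤₚ.*-zeroʳ (c (true ∷ S))))))
  (ℤₚ.+-identityʳ _)

evalPoly-true-false : ∀ {n} (c : Subset (suc n) → ℤ) y →
                      evalPoly c (true ∷ y) ℤ.- evalPoly c (false ∷ y) ≡ evalPoly (λ S → c (true ∷ S)) y
evalPoly-true-false c y = begin
  evalPoly c (true ∷ y) ℤ.- evalPoly c (false ∷ y)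
    ≡⟨ cong₂ (λ u v → (c₀ ℤ.+ u) ℤ.- v)
             (sumAll-cong (λ S → cong (c (true ∷ S) ℤ.*_) (ℤₚ.*-identityˡ (monomial S y))))
             (evalPoly-false c y) ⟩
  (c₀ ℤ.+ c₁) ℤ.- c₀
    ≡⟨ cancel c₀ c₁ ⟩
  c₁ ∎
  where
  open ≡-Reasoning
  c₀ = evalPoly (λ S → c (false ∷ S)) y
  c₁ = evalPoly (λ S → c (true ∷ S)) y
  cancel : ∀ a b → (a ℤ.+ b) ℤ.- a ≡ b
  cancel = solve-∀

∂-evalPoly : ∀ {n} (c : Subset n → ℤ) M → ∂ M (evalPoly c) 𝟎 ≡ c M
∂-evalPoly c []          = ℤₚ.*-identityʳ (c [])
∂-evalPoly c (true ∷ M)  = begin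
  ∂ M (λ y → evalPoly c (true ∷ y)) 𝟎 ℤ.- ∂ M (λ y → evalPoly c (false ∷ y)) 𝟎
    ≡⟨ ∂-difference M _ _ 𝟎 ⟨
  ∂ M (λ y → evalPoly c (true ∷ y) ℤ.- evalPoly c (false ∷ y)) 𝟎
    ≡⟨ ∂-cong M (evalPoly-true-false c) 𝟎 ⟩
  ∂ M (evalPoly (λ S → c (true ∷ S))) 𝟎
    ≡⟨ ∂-evalPoly (λ S → c (true ∷ S)) M ⟩
  c (true ∷ M) ∎
  where open ≡-Reasoning
∂-evalPoly c (false ∷ M) =
  trans (∂-cong M (evalPoly-false c) 𝟎) (∂-evalPoly (λ S → c (false ∷ S)) M)

coefficient≡∂ : ∀ {n} (c : Subset n → ℤ) {f : BoolFun n} → Represents c f →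
                ∀ M → c M ≡ ∂ M (λ x → b2ℤ (f x)) 𝟎
coefficient≡∂ c rep M = trans (sym (∂-evalPoly c M)) (∂-cong M rep 𝟎)

embed : ∀ {n} (T : Subset n) → Input n → Input ∣ T ∣ → Input n
embed []          []      []      = []
embed (true ∷ T)  (_ ∷ w) (b ∷ x) = b ∷ embed T w x
embed (false ∷ T) (c ∷ w) x       = c ∷ embed T w x

position : ∀ {n} (T : Subset n) → Fin ∣ T ∣ → Fin n
position (true ∷ T)  zero    = zero
position (true ∷ T)  (suc j) = suc (position T j)
position (false ∷ T) j       = suc (position T j)

position-∈ : ∀ {n} (T : Subset n) j → position T j ∈ T
position-∈ (true ∷ T)  zero    = here
position-∈ (true ∷ T)  (suc j) = there (position-∈ T j)
position-∈ (false ∷ T) j       = there (position-∈ T j)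

flipBit-embed : ∀ {n} (T : Subset n) w x j →
                flipBit (position T j) (embed T w x) ≡ embed T w (flipBit j x)
flipBit-embed (true ∷ T)  (_ ∷ w) (b ∷ x) zero    = refl
flipBit-embed (true ∷ T)  (_ ∷ w) (b ∷ x) (suc j) = cong (b ∷_) (flipBit-embed T w x j)
flipBit-embed (false ∷ T) (c ∷ w) x       j       = cong (c ∷_) (flipBit-embed T w x j)

differs-embed : ∀ {n} (f : BoolFun n) (T : Subset n) w x j →
                differs f (position T j) (embed T w x) ≡ differs (f ∘ embed T w) j x
differs-embed f T w x j = cong (λ z → f (embed T w x) xor f z) (flipBit-embed T w x j)

sensAt-embed : ∀ {n} (f : BoolFun n) (T : Subset n) w x →
               sensAt (f ∘ embed T w) x ≤ sensAt f (embed T w x)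
sensAt-embed f []          []      []      = z≤n
sensAt-embed f (true ∷ T)  (c ∷ w) (b ∷ x)
  rewrite sensAt-∷ (f ∘ embed (true ∷ T) (c ∷ w)) b x | sensAt-∷ f b (embed T w x) =
  ℕₚ.+-monoʳ-≤ _ (sensAt-embed (λ y → f (b ∷ y)) T w x)
sensAt-embed f (false ∷ T) (c ∷ w) x
  rewrite sensAt-∷ f c (embed T w x) =
  ℕₚ.≤-trans (sensAt-embed (λ y → f (c ∷ y)) T w x) (ℕₚ.m≤n+m _ _)

∂-embed : ∀ {n} (T : Subset n) (G : Input n → ℤ) w → ∂ T G w ≡ ∂ ⊤ (G ∘ embed T w) 𝟎
∂-embed []          G []      = refl
∂-embed (true ∷ T)  G (_ ∷ w) =
  cong₂ ℤ._-_ (∂-embed T (λ y → G (true ∷ y)) w) (∂-embed T (λ y → G (false ∷ y)) w)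
∂-embed (false ∷ T) G (b ∷ w) = ∂-embed T _ w

∂-nonzero-⊆ : ∀ {n} {T M : Subset n} → T ⊆ M → ∀ G w → ∂ M G w ≢ + 0 → ∃ λ w′ → ∂ T G w′ ≢ + 0
∂-nonzero-⊆ {T = []}        {[]}        T⊆M G []      ∂≢0 = [] , ∂≢0
∂-nonzero-⊆ {T = true ∷ T}  {true ∷ M}  T⊆M G (_ ∷ w) ∂≢0 =
  let w′ , ∂′≢0 = ∂-nonzero-⊆ (drop-∷-⊆ T⊆M) (λ y → G (true ∷ y) ℤ.- G (false ∷ y)) w
                              (λ ∂≡0 → ∂≢0 (trans (sym (∂-difference M _ _ w)) ∂≡0))
  in (true ∷ w′) , (λ ∂≡0 → ∂′≢0 (trans (∂-difference T _ _ w′) ∂≡0))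
∂-nonzero-⊆ {T = false ∷ T} {true ∷ M}  T⊆M G (_ ∷ w) ∂≢0
  with ∂ M (λ y → G (true ∷ y)) w ℤₚ.≟ + 0
... | no ∂₁≢0 = let w′ , ∂′≢0 = ∂-nonzero-⊆ (drop-∷-⊆ T⊆M) _ w ∂₁≢0 in (true ∷ w′) , ∂′≢0
... | yes ∂₁≡0 =
  let w′ , ∂′≢0 = ∂-nonzero-⊆ (drop-∷-⊆ T⊆M) _ w (λ ∂₀≡0 → ∂≢0 (cong₂ ℤ._-_ ∂₁≡0 ∂₀≡0))
  in (false ∷ w′) , ∂′≢0
∂-nonzero-⊆ {T = true ∷ T}  {false ∷ M} T⊆M G w ∂≢0 with T⊆M here
... | ()
∂-nonzero-⊆ {T = false ∷ T} {false ∷ M} T⊆M G (b ∷ w) ∂≢0 =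
  let w′ , ∂′≢0 = ∂-nonzero-⊆ (drop-∷-⊆ T⊆M) _ w ∂≢0 in (b ∷ w′) , ∂′≢0

-- Huang's signed adjacency operator

-- Acting on functions, this is Huang's matrix A_{t+1} = [[A_t, I], [I, -A_t]], split by the first bit.
A : ∀ {t} → (Input t → ℤ) → Input t → ℤ
A {zero}  u _           = + 0
A {suc t} u (false ∷ x) = A (λ y → u (false ∷ y)) x ℤ.+ u (true ∷ x)
A {suc t} u (true ∷ x)  = u (false ∷ x) ℤ.- A (λ y → u (true ∷ y)) x

A-0 : ∀ {t} (x : Input t) → A (λ _ → + 0) x ≡ + 0
A-0 {zero}  x           = refl
A-0 {suc t} (false ∷ x) = cong (ℤ._+ + 0) (A-0 x)
A-0 {suc t} (true ∷ x)  = cong (λ z → + 0 ℤ.- z) (A-0 x)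

A-+ : ∀ {t} (u v : Input t → ℤ) x → A (λ y → u y ℤ.+ v y) x ≡ A u x ℤ.+ A v x
A-+ {zero}  u v x           = refl
A-+ {suc t} u v (false ∷ x) =
  trans (cong (ℤ._+ (u (true ∷ x) ℤ.+ v (true ∷ x))) (A-+ u₀ v₀ x))
        (shuffle (A u₀ x) (A v₀ x) (u (true ∷ x)) (v (true ∷ x)))
  where
  u₀ v₀ : _ → ℤ
  u₀ y = u (false ∷ y)
  v₀ y = v (false ∷ y)
  shuffle : ∀ a b c d → (a ℤ.+ b) ℤ.+ (c ℤ.+ d) ≡ (a ℤ.+ c) ℤ.+ (b ℤ.+ d)
  shuffle = solve-∀
A-+ {suc t} u v (true ∷ x)  =
  trans (cong (λ z → (u (false ∷ x) ℤ.+ v (false ∷ x)) ℤ.- z) (A-+ u₁ v₁ x))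
        (shuffle (u (false ∷ x)) (v (false ∷ x)) (A u₁ x) (A v₁ x))
  where
  u₁ v₁ : _ → ℤ
  u₁ y = u (true ∷ y)
  v₁ y = v (true ∷ y)
  shuffle : ∀ a b c d → (a ℤ.+ b) ℤ.- (c ℤ.+ d) ≡ (a ℤ.- c) ℤ.+ (b ℤ.- d)
  shuffle = solve-∀

A-difference : ∀ {t} (u v : Input t → ℤ) x → A (λ y → u y ℤ.- v y) x ≡ A u x ℤ.- A v x
A-difference {zero}  u v x           = refl
A-difference {suc t} u v (false ∷ x) =
  trans (cong (ℤ._+ (u (true ∷ x) ℤ.- v (true ∷ x))) (A-difference u₀ v₀ x))
        (shuffle (A u₀ x) (A v₀ x) (u (true ∷ x)) (v (true ∷ x)))
  where
  u₀ v₀ : _ → ℤ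
  u₀ y = u (false ∷ y)
  v₀ y = v (false ∷ y)
  shuffle : ∀ a b c d → (a ℤ.- b) ℤ.+ (c ℤ.- d) ≡ (a ℤ.+ c) ℤ.- (b ℤ.+ d)
  shuffle = solve-∀
A-difference {suc t} u v (true ∷ x)  =
  trans (cong (λ z → (u (false ∷ x) ℤ.- v (false ∷ x)) ℤ.- z) (A-difference u₁ v₁ x))
        (shuffle (u (false ∷ x)) (v (false ∷ x)) (A u₁ x) (A v₁ x))
  where
  u₁ v₁ : _ → ℤ
  u₁ y = u (true ∷ y)
  v₁ y = v (true ∷ y)
  shuffle : ∀ a b c d → (a ℤ.- b) ℤ.- (c ℤ.- d) ≡ (a ℤ.- c) ℤ.- (b ℤ.- d)
  shuffle = solve-∀

A-* : ∀ {t} (c : ℤ) (u : Input t → ℤ) x → A (λ y → c ℤ.* u y) x ≡ c ℤ.* A u x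
A-* {zero}  c u x           = sym (ℤₚ.*-zeroʳ c)
A-* {suc t} c u (false ∷ x) =
  trans (cong (ℤ._+ (c ℤ.* u (true ∷ x))) (A-* c (λ y → u (false ∷ y)) x))
        (sym (ℤₚ.*-distribˡ-+ c (A (λ y → u (false ∷ y)) x) (u (true ∷ x))))
A-* {suc t} c u (true ∷ x)  =
  trans (cong (λ z → c ℤ.* u (false ∷ x) ℤ.- z) (A-* c (λ y → u (true ∷ y)) x))
        (distrib c (u (false ∷ x)) (A (λ y → u (true ∷ y)) x))
  where
  distrib : ∀ c a b → c ℤ.* a ℤ.- c ℤ.* b ≡ c ℤ.* (a ℤ.- b)
  distrib = solve-∀

A²≡t* : ∀ {t} (u : Input t → ℤ) x → A (A u) x ≡ + t ℤ.* u x
A²≡t* {zero}  u x = refl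
A²≡t* {suc t} u (false ∷ x) = begin
  A (λ y → A u₀ y ℤ.+ u₁ y) x ℤ.+ (u₀ x ℤ.- A u₁ x) ≡⟨ cong (ℤ._+ (u₀ x ℤ.- A u₁ x)) (A-+ (A u₀) u₁ x) ⟩
  (A (A u₀) x ℤ.+ A u₁ x) ℤ.+ (u₀ x ℤ.- A u₁ x)    ≡⟨ cong (λ z → (z ℤ.+ A u₁ x) ℤ.+ (u₀ x ℤ.- A u₁ x)) (A²≡t* u₀ x) ⟩
  (+ t ℤ.* u₀ x ℤ.+ A u₁ x) ℤ.+ (u₀ x ℤ.- A u₁ x)  ≡⟨ collect (+ t) (u₀ x) (A u₁ x) ⟩
  + suc t ℤ.* u₀ x ∎
  where
  open ≡-Reasoning
  u₀ u₁ : _ → ℤ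
  u₀ y = u (false ∷ y)
  u₁ y = u (true ∷ y)
  collect : ∀ t a b → (t ℤ.* a ℤ.+ b) ℤ.+ (a ℤ.- b) ≡ (+ 1 ℤ.+ t) ℤ.* a
  collect = solve-∀
A²≡t* {suc t} u (true ∷ x) = begin
  (A u₀ x ℤ.+ u₁ x) ℤ.- A (λ y → u₀ y ℤ.- A u₁ y) x ≡⟨ cong (λ z → (A u₀ x ℤ.+ u₁ x) ℤ.- z) (A-difference u₀ (A u₁) x) ⟩
  (A u₀ x ℤ.+ u₁ x) ℤ.- (A u₀ x ℤ.- A (A u₁) x)    ≡⟨ cong (λ z → (A u₀ x ℤ.+ u₁ x) ℤ.- (A u₀ x ℤ.- z)) (A²≡t* u₁ x) ⟩
  (A u₀ x ℤ.+ u₁ x) ℤ.- (A u₀ x ℤ.- + t ℤ.* u₁ x)  ≡⟨ collect (+ t) (A u₀ x) (u₁ x) ⟩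
  + suc t ℤ.* u₁ x ∎
  where
  open ≡-Reasoning
  u₀ u₁ : _ → ℤ
  u₀ y = u (false ∷ y)
  u₁ y = u (true ∷ y)
  collect : ∀ t a b → (a ℤ.+ b) ℤ.- (a ℤ.- t ℤ.* b) ≡ (+ 1 ℤ.+ t) ℤ.* b
  collect = solve-∀

degree : ∀ {t} → (Input t → Bool) → Input t → ℕ
degree {t} H x = foldr′ (λ i acc → ⟦ H (flipBit i x) ⟧ ℕ.+ acc) 0 (allFin t)

degree-∷ : ∀ {t} (H : Input (suc t) → Bool) b x →
           degree H (b ∷ x) ≡ ⟦ H (not b ∷ x) ⟧ ℕ.+ degree (λ y → H (b ∷ y)) x
degree-∷ H b x = foldr′-allFin-suc (λ i acc → ⟦ H (flipBit i (b ∷ x)) ⟧ ℕ.+ acc) 0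

∣A∣≤degree* : ∀ {t} (H : Input t → Bool) (u : Input t → ℤ) K → (∀ y → ℤ.∣ u y ∣ ≤ ⟦ H y ⟧ ℕ.* K) →
              ∀ x → ℤ.∣ A u x ∣ ≤ degree H x ℕ.* K
∣A∣≤degree* {zero}  H u K u≤ x = z≤n
∣A∣≤degree* {suc t} H u K u≤ (false ∷ x) rewrite degree-∷ H false x = begin
  ℤ.∣ A (λ y → u (false ∷ y)) x ℤ.+ u (true ∷ x) ∣
    ≤⟨ ℤₚ.∣i+j∣≤∣i∣+∣j∣ (A (λ y → u (false ∷ y)) x) (u (true ∷ x)) ⟩
  ℤ.∣ A (λ y → u (false ∷ y)) x ∣ ℕ.+ ℤ.∣ u (true ∷ x) ∣
    ≤⟨ ℕₚ.+-mono-≤ (∣A∣≤degree* (λ y → H (false ∷ y)) (λ y → u (false ∷ y)) K (u≤ ∘ (false ∷_)) x) (u≤ (true ∷ x)) ⟩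
  degree (λ y → H (false ∷ y)) x ℕ.* K ℕ.+ ⟦ H (true ∷ x) ⟧ ℕ.* K
    ≡⟨ ℕₚ.+-comm (degree (λ y → H (false ∷ y)) x ℕ.* K) (⟦ H (true ∷ x) ⟧ ℕ.* K) ⟩
  ⟦ H (true ∷ x) ⟧ ℕ.* K ℕ.+ degree (λ y → H (false ∷ y)) x ℕ.* K
    ≡⟨ ℕₚ.*-distribʳ-+ K ⟦ H (true ∷ x) ⟧ (degree (λ y → H (false ∷ y)) x) ⟨
  (⟦ H (true ∷ x) ⟧ ℕ.+ degree (λ y → H (false ∷ y)) x) ℕ.* K ∎
  where open ℕₚ.≤-Reasoning
∣A∣≤degree* {suc t} H u K u≤ (true ∷ x) rewrite degree-∷ H true x = begin
  ℤ.∣ u (false ∷ x) ℤ.- A (λ y → u (true ∷ y)) x ∣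
    ≤⟨ ℤₚ.∣i-j∣≤∣i∣+∣j∣ (u (false ∷ x)) (A (λ y → u (true ∷ y)) x) ⟩
  ℤ.∣ u (false ∷ x) ∣ ℕ.+ ℤ.∣ A (λ y → u (true ∷ y)) x ∣
    ≤⟨ ℕₚ.+-mono-≤ (u≤ (false ∷ x)) (∣A∣≤degree* (λ y → H (true ∷ y)) (λ y → u (true ∷ y)) K (u≤ ∘ (true ∷_)) x) ⟩
  ⟦ H (false ∷ x) ⟧ ℕ.* K ℕ.+ degree (λ y → H (true ∷ y)) x ℕ.* K
    ≡⟨ ℕₚ.*-distribʳ-+ K ⟦ H (false ∷ x) ⟧ (degree (λ y → H (true ∷ y)) x) ⟨
  (⟦ H (false ∷ x) ⟧ ℕ.+ degree (λ y → H (true ∷ y)) x) ℕ.* K ∎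
  where open ℕₚ.≤-Reasoning

-- Integer linear algebra

module _ {X Y : Set} where

  lincomb : (X → ℤ) → (X → Y → ℤ) → List X → Y → ℤ
  lincomb a φ []       y = + 0
  lincomb a φ (x ∷ xs) y = a x ℤ.* φ x y ℤ.+ lincomb a φ xs y

  lincomb-++-∷ : ∀ a φ P x Q y → lincomb a φ (P ++ x ∷ Q) y ≡ a x ℤ.* φ x y ℤ.+ lincomb a φ (P ++ Q) y
  lincomb-++-∷ a φ []       x Q y = refl
  lincomb-++-∷ a φ (p ∷ P) x Q y =
    trans (cong (λ z → a p ℤ.* φ p y ℤ.+ z) (lincomb-++-∷ a φ P x Q y))
          (left-comm (a p ℤ.* φ p y) (a x ℤ.* φ x y) (lincomb a φ (P ++ Q) y))
    where
    left-comm : ∀ a b c → a ℤ.+ (b ℤ.+ c) ≡ b ℤ.+ (a ℤ.+ c)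
    left-comm = solve-∀

  lincomb-cong : ∀ {a b} φ xs y → (∀ {x} → x ∈ₗ xs → a x ≡ b x) → lincomb a φ xs y ≡ lincomb b φ xs y
  lincomb-cong φ []       y e = refl
  lincomb-cong φ (x ∷ xs) y e =
    cong₂ (λ c r → c ℤ.* φ x y ℤ.+ r) (e (hereₗ refl)) (lincomb-cong φ xs y (e ∘ thereₗ))

  lincomb-0 : ∀ a φ xs y → (∀ {x} → x ∈ₗ xs → φ x y ≡ + 0) → lincomb a φ xs y ≡ + 0
  lincomb-0 a φ []       y e = refl
  lincomb-0 a φ (x ∷ xs) y e = begin
    a x ℤ.* φ x y ℤ.+ lincomb a φ xs y ≡⟨ cong₂ (λ c r → a x ℤ.* c ℤ.+ r) (e (hereₗ refl)) (lincomb-0 a φ xs y (e ∘ thereₗ)) ⟩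
    a x ℤ.* + 0 ℤ.+ + 0                ≡⟨ cong (ℤ._+ + 0) (ℤₚ.*-zeroʳ (a x)) ⟩
    + 0 ∎
    where open ≡-Reasoning

  lincomb-* : ∀ c a φ xs y → lincomb (λ x → c ℤ.* a x) φ xs y ≡ c ℤ.* lincomb a φ xs y
  lincomb-* c a φ []       y = sym (ℤₚ.*-zeroʳ c)
  lincomb-* c a φ (x ∷ xs) y =
    trans (cong (λ r → c ℤ.* a x ℤ.* φ x y ℤ.+ r) (lincomb-* c a φ xs y))
          (distrib c (a x) (φ x y) (lincomb a φ xs y))
    where
    distrib : ∀ c a f r → c ℤ.* a ℤ.* f ℤ.+ c ℤ.* r ≡ c ℤ.* (a ℤ.* f ℤ.+ r)
    distrib = solve-∀

  lincomb-rowOp : ∀ a φ p y (ψ : Y → ℤ) xs z →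
                  lincomb a (λ x w → p ℤ.* φ x w ℤ.- φ x y ℤ.* ψ w) xs z ≡
                  p ℤ.* lincomb a φ xs z ℤ.- lincomb a φ xs y ℤ.* ψ z
  lincomb-rowOp a φ p y ψ []       z = zeros p (ψ z)
    where
    zeros : ∀ p q → + 0 ≡ p ℤ.* + 0 ℤ.- + 0 ℤ.* q
    zeros = solve-∀
  lincomb-rowOp a φ p y ψ (x ∷ xs) z =
    trans (cong (λ r → a x ℤ.* (p ℤ.* φ x z ℤ.- φ x y ℤ.* ψ z) ℤ.+ r) (lincomb-rowOp a φ p y ψ xs z))
          (regroup p (a x) (φ x z) (φ x y) (ψ z) (lincomb a φ xs z) (lincomb a φ xs y))
    where
    regroup : ∀ p a f g h l₁ l₂ → a ℤ.* (p ℤ.* f ℤ.- g ℤ.* h) ℤ.+ (p ℤ.* l₁ ℤ.- l₂ ℤ.* h)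
                                  ≡ p ℤ.* (a ℤ.* f ℤ.+ l₁) ℤ.- (a ℤ.* g ℤ.+ l₂) ℤ.* h
    regroup = solve-∀

  findPivot : (ψ : X → ℤ) (xs : List X) →
              (∃₂ λ P Q → ∃ λ x → xs ≡ P ++ x ∷ Q × ψ x ≢ + 0) ⊎ (∀ {x} → x ∈ₗ xs → ψ x ≡ + 0)
  findPivot ψ []       = inj₂ λ ()
  findPivot ψ (x ∷ xs) with ψ x ℤₚ.≟ + 0 | findPivot ψ xs
  ... | no ψx≢0 | _                              = inj₁ ([] , xs , x , refl , ψx≢0)
  ... | yes _   | inj₁ (P , Q , x₀ , refl , ψx₀≢0) = inj₁ (x ∷ P , Q , x₀ , refl , ψx₀≢0)
  ... | yes ψx≡0 | inj₂ ψ≡0                        = inj₂ λ { (hereₗ refl) → ψx≡0 ; (thereₗ m) → ψ≡0 m }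

  Unique-remove : ∀ P {x : X} Q → Unique (P ++ x ∷ Q) → x ∉ₗ P ++ Q × Unique (P ++ Q)
  Unique-remove []       Q (x≢Q ∷ u) = Allₚ.All¬⇒¬Any x≢Q , u
  Unique-remove (p ∷ P) Q (p≢ ∷ u) with Unique-remove P Q u | Allₚ.++⁻ P p≢
  ... | x∉ , u′ | p≢P , p≢x ∷ p≢Q =
    (λ { (hereₗ x≡p) → p≢x (sym x≡p) ; (thereₗ m) → x∉ m }) , (Allₚ.++⁺ p≢P p≢Q ∷ u′)

  record NontrivialSolution (φ : X → Y → ℤ) (xs : List X) (ys : List Y) : Set where
    field
      coeff    : X → ℤ
      witness  : X
      witness∈ : witness ∈ₗ xs
      coeff≢0  : coeff witness ≢ + 0
      solves   : ∀ {y} → y ∈ₗ ys → lincomb coeff φ xs y ≡ + 0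

  eliminate : (X → Y → ℤ) → X → Y → X → Y → ℤ
  eliminate φ x₀ y x w = φ x₀ y ℤ.* φ x w ℤ.- φ x y ℤ.* φ x₀ w

  lift-solution : DecidableEquality X → ∀ φ P x₀ Q {y ys} → x₀ ∉ₗ P ++ Q → φ x₀ y ≢ + 0 →
                  NontrivialSolution (eliminate φ x₀ y) (P ++ Q) ys → NontrivialSolution φ (P ++ x₀ ∷ Q) (y ∷ ys)
  lift-solution _≟_ φ P x₀ Q {y} x₀∉ p≢0 s = record
    { coeff    = a
    ; witness  = witness
    ; witness∈ = Permₚ.∈-resp-↭ (↭-sym (Permₚ.shift x₀ P Q)) (thereₗ witness∈)
    ; coeff≢0  = a-witness≢0
    ; solves   = λ { (hereₗ refl) → trans (reduce y) (lincomb-0 coeff (eliminate φ x₀ y) (P ++ Q) y cleared)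
                   ; (thereₗ m)   → trans (reduce _) (solves m) } }
    where
    open NontrivialSolution s
    p = φ x₀ y
    σ = lincomb coeff φ (P ++ Q) y
    a : X → ℤ
    a x = if does (x ≟ x₀) then ℤ.- σ else p ℤ.* coeff x
    a-pivot : a x₀ ≡ ℤ.- σ
    a-pivot = cong (λ d → if d then ℤ.- σ else p ℤ.* coeff x₀) (dec-true (x₀ ≟ x₀) refl)
    a-other : ∀ {x} → x ∈ₗ P ++ Q → a x ≡ p ℤ.* coeff x
    a-other {x} m = cong (λ d → if d then ℤ.- σ else p ℤ.* coeff x)
                         (dec-false (x ≟ x₀) (λ x≡x₀ → x₀∉ (subst (_∈ₗ P ++ Q) x≡x₀ m)))
    a-witness≢0 : a witness ≢ + 0
    a-witness≢0 a≡0 with ℤₚ.i*j≡0⇒i≡0∨j≡0 p (trans (sym (a-other witness∈)) a≡0)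
    ... | inj₁ p≡0 = p≢0 p≡0
    ... | inj₂ c≡0 = coeff≢0 c≡0
    reduce : ∀ w → lincomb a φ (P ++ x₀ ∷ Q) w ≡ lincomb coeff (eliminate φ x₀ y) (P ++ Q) w
    reduce w = begin
      lincomb a φ (P ++ x₀ ∷ Q) w
        ≡⟨ lincomb-++-∷ a φ P x₀ Q w ⟩
      a x₀ ℤ.* φ x₀ w ℤ.+ lincomb a φ (P ++ Q) w
        ≡⟨ cong₂ (λ c r → c ℤ.* φ x₀ w ℤ.+ r) a-pivot (lincomb-cong φ (P ++ Q) w a-other) ⟩
      ℤ.- σ ℤ.* φ x₀ w ℤ.+ lincomb (λ x → p ℤ.* coeff x) φ (P ++ Q) w
        ≡⟨ cong (λ r → ℤ.- σ ℤ.* φ x₀ w ℤ.+ r) (lincomb-* p coeff φ (P ++ Q) w) ⟩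
      ℤ.- σ ℤ.* φ x₀ w ℤ.+ p ℤ.* lincomb coeff φ (P ++ Q) w
        ≡⟨ swap σ (φ x₀ w) (p ℤ.* lincomb coeff φ (P ++ Q) w) ⟩
      p ℤ.* lincomb coeff φ (P ++ Q) w ℤ.- σ ℤ.* φ x₀ w
        ≡⟨ lincomb-rowOp coeff φ p y (φ x₀) (P ++ Q) w ⟨
      lincomb coeff (eliminate φ x₀ y) (P ++ Q) w ∎
      where
      open ≡-Reasoning
      swap : ∀ s f l → ℤ.- s ℤ.* f ℤ.+ l ≡ l ℤ.- s ℤ.* f
      swap = solve-∀
    cleared : ∀ {x} → x ∈ₗ P ++ Q → eliminate φ x₀ y x y ≡ + 0
    cleared {x} _ = cancel p (φ x y)
      where
      cancel : ∀ p g → p ℤ.* g ℤ.- g ℤ.* p ≡ + 0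
      cancel = solve-∀

  nontrivialSolution : DecidableEquality X → (φ : X → Y → ℤ) (xs : List X) (ys : List Y) →
                       Unique xs → length ys < length xs → NontrivialSolution φ xs ys
  nontrivialSolution _≟_ φ (x ∷ xs) [] _ _ =
    record { coeff = λ _ → + 1 ; witness = x ; witness∈ = hereₗ refl ; coeff≢0 = λ () ; solves = λ () }
  nontrivialSolution _≟_ φ xs (y ∷ ys) u ys<xs with findPivot (λ x → φ x y) xs
  ... | inj₂ φ·y≡0 = record
    { coeff = coeff ; witness = witness ; witness∈ = witness∈ ; coeff≢0 = coeff≢0
    ; solves = λ { (hereₗ refl) → lincomb-0 coeff φ xs y φ·y≡0 ; (thereₗ m) → solves m } }
    where open NontrivialSolution (nontrivialSolution _≟_ φ xs ys u (ℕₚ.<-trans (ℕₚ.n<1+n _) ys<xs))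
  ... | inj₁ (P , Q , x₀ , refl , p≢0) =
    let x₀∉ , u′ = Unique-remove P Q u
        ys<P++Q  = ℕₚ.≤-pred (subst (length (y ∷ ys) <_) (Listₚ.length-++-sucʳ P x₀ Q) ys<xs)
    in lift-solution _≟_ φ P x₀ Q x₀∉ p≢0 (nontrivialSolution _≟_ (eliminate φ x₀ y) (P ++ Q) ys u′ ys<P++Q)

module _ {X : Set} (_≟_ : DecidableEquality X) where

  basis : X → X → ℤ
  basis x z = if does (x ≟ z) then + 1 else + 0

  lincomb-basis-∉ : ∀ a xs {z} → z ∉ₗ xs → lincomb a basis xs z ≡ + 0
  lincomb-basis-∉ a xs {z} z∉ = lincomb-0 a basis xs z λ {x} x∈ →
    cong (λ d → if d then + 1 else + 0) (dec-false (x ≟ z) (λ x≡z → z∉ (subst (_∈ₗ xs) x≡z x∈)))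

  lincomb-basis-∈ : ∀ a {xs} → Unique xs → ∀ {z} → z ∈ₗ xs → lincomb a basis xs z ≡ a z
  lincomb-basis-∈ a {z ∷ xs} (z≢ ∷ _) (hereₗ refl) = begin
    a z ℤ.* basis z z ℤ.+ lincomb a basis xs z
      ≡⟨ cong₂ (λ d r → a z ℤ.* (if d then + 1 else + 0) ℤ.+ r)
               (dec-true (z ≟ z) refl) (lincomb-basis-∉ a xs (Allₚ.All¬⇒¬Any z≢)) ⟩
    a z ℤ.* + 1 ℤ.+ + 0
      ≡⟨ trans (ℤₚ.+-identityʳ _) (ℤₚ.*-identityʳ (a z)) ⟩
    a z ∎
    where open ≡-Reasoning
  lincomb-basis-∈ a {x ∷ xs} (x≢ ∷ u) {z} (thereₗ z∈) = begin
    a x ℤ.* basis x z ℤ.+ lincomb a basis xs z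
      ≡⟨ cong₂ (λ d r → a x ℤ.* (if d then + 1 else + 0) ℤ.+ r)
               (dec-false (x ≟ z) (All.lookup x≢ z∈)) (lincomb-basis-∈ a u z∈) ⟩
    a x ℤ.* + 0 ℤ.+ a z
      ≡⟨ trans (cong (ℤ._+ a z) (ℤₚ.*-zeroʳ (a x))) (ℤₚ.+-identityˡ (a z)) ⟩
    a z ∎
    where open ≡-Reasoning

-- Huang's sensitivity theorem

A-lincomb : ∀ {X : Set} {t} (a : X → ℤ) (φ : X → Input t → ℤ) xs y →
            A (lincomb a φ xs) y ≡ lincomb a (λ x → A (φ x)) xs y
A-lincomb a φ []       y = A-0 y
A-lincomb a φ (x ∷ xs) y =
  trans (A-+ (λ z → a x ℤ.* φ x z) (lincomb a φ xs) y)
        (cong₂ ℤ._+_ (A-* (a x) (φ x) y) (A-lincomb a φ xs y))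

maxAll-attained : ∀ {t} (φ : Input t → ℕ) → ∃ λ x → φ x ≡ maxAll φ
maxAll-attained {zero}  φ = [] , refl
maxAll-attained {suc t} φ
  with ℕₚ.⊔-sel (maxAll (λ y → φ (false ∷ y))) (maxAll (λ y → φ (true ∷ y)))
     | maxAll-attained (λ y → φ (false ∷ y)) | maxAll-attained (λ y → φ (true ∷ y))
... | inj₁ max≡₀ | x , φx≡ | _ = (false ∷ x) , trans φx≡ (sym max≡₀)
... | inj₂ max≡₁ | _ | x , φx≡ = (true ∷ x) , trans φx≡ (sym max≡₁)

argmax : ∀ {t} (φ : Input t → ℕ) → ∃ λ x₀ → ∀ x → φ x ≤ φ x₀
argmax φ = let x₀ , φx₀≡max = maxAll-attained φ in
  x₀ , λ x → subst (φ x ≤_) (sym φx₀≡max) (maxAll-≥ φ x)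

≤⟦⟧* : ∀ b n K → (b ≡ true → n ≤ K) → (b ≡ false → n ≡ 0) → n ≤ ⟦ b ⟧ ℕ.* K
≤⟦⟧* true  n K n≤K _   = subst (n ≤_) (sym (ℕₚ.*-identityˡ K)) (n≤K refl)
≤⟦⟧* false n K _   n≡0 = ℕₚ.≤-reflexive (n≡0 refl)

points : ∀ {t} → (Input t → Bool) → List (Input t)
points {zero}  H = if H [] then [] ∷ [] else []
points {suc t} H = List.map (false ∷_) (points (λ y → H (false ∷ y)))
                ++ List.map (true ∷_) (points (λ y → H (true ∷ y)))

∈-points⁺ : ∀ {t} (H : Input t → Bool) {x} → H x ≡ true → x ∈ₗ points H
∈-points⁺ {zero}  H {[]}        Hx rewrite Hx = hereₗ refl
∈-points⁺ {suc t} H {false ∷ x} Hx =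
  ∈-++⁺ˡ (∈-map⁺ (false ∷_) (∈-points⁺ (λ y → H (false ∷ y)) Hx))
∈-points⁺ {suc t} H {true ∷ x}  Hx =
  ∈-++⁺ʳ (List.map (false ∷_) (points (λ y → H (false ∷ y))))
         (∈-map⁺ (true ∷_) (∈-points⁺ (λ y → H (true ∷ y)) Hx))

∈-points⁻ : ∀ {t} (H : Input t → Bool) {x} → x ∈ₗ points H → H x ≡ true
∈-points⁻ {zero}  H {[]} m  with H []
∈-points⁻ {zero}  H {[]} m  | true = refl
∈-points⁻ {zero}  H {[]} () | false
∈-points⁻ {suc t} H m with ∈-++⁻ (List.map (false ∷_) (points (λ y → H (false ∷ y)))) m
... | inj₁ m₀ with ∈-map⁻ (false ∷_) m₀
...   | _ , m , refl = ∈-points⁻ (λ y → H (false ∷ y)) m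
∈-points⁻ {suc t} H m | inj₂ m₁ with ∈-map⁻ (true ∷_) m₁
...   | _ , m , refl = ∈-points⁻ (λ y → H (true ∷ y)) m

points-unique : ∀ {t} (H : Input t → Bool) → Unique (points H)
points-unique {zero}  H with H []
... | true  = [] ∷ []
... | false = []
points-unique {suc t} H =
  Uniqueₚ.++⁺ (Uniqueₚ.map⁺ Vecₚ.∷-injectiveʳ (points-unique (λ y → H (false ∷ y))))
              (Uniqueₚ.map⁺ Vecₚ.∷-injectiveʳ (points-unique (λ y → H (true ∷ y))))
              disjoint
  where
  disjoint : ∀ {v} → ¬ (v ∈ₗ List.map (false ∷_) (points (λ y → H (false ∷ y)))
                        × v ∈ₗ List.map (true ∷_) (points (λ y → H (true ∷ y))))
  disjoint (m₀ , m₁) with ∈-map⁻ (false ∷_) m₀ | ∈-map⁻ (true ∷_) m₁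
  ... | _ , _ , refl | _ , _ , ()

sign : Bool → ℤ
sign b = if b then + 1 else ℤ.-1ℤ

length-points-∷ : ∀ {t} (H : Input (suc t) → Bool) →
                  length (points H) ≡ length (points (λ y → H (false ∷ y))) ℕ.+ length (points (λ y → H (true ∷ y)))
length-points-∷ H = trans (Listₚ.length-++ (List.map (false ∷_) (points (λ y → H (false ∷ y)))))
  (cong₂ ℕ._+_ (Listₚ.length-map (false ∷_) (points (λ y → H (false ∷ y))))
               (Listₚ.length-map (true ∷_) (points (λ y → H (true ∷ y)))))

points-balance : ∀ {t} (H : Input t → Bool) →
                 + length (points H) ℤ.- + length (points (λ x → not (H x))) ≡ sumAll (λ x → sign (H x))
points-balance {zero} H with H []
... | true  = refl
... | false = refl
points-balance {suc t} H = begin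
  + length (points H) ℤ.- + length (points H̄)
    ≡⟨ cong₂ (λ m n → + m ℤ.- + n) (length-points-∷ H) (length-points-∷ H̄) ⟩
  + (p₀ ℕ.+ p₁) ℤ.- + (n₀ ℕ.+ n₁)
    ≡⟨ cong₂ ℤ._-_ (ℤₚ.pos-+ p₀ p₁) (ℤₚ.pos-+ n₀ n₁) ⟩
  (+ p₀ ℤ.+ + p₁) ℤ.- (+ n₀ ℤ.+ + n₁)
    ≡⟨ shuffle (+ p₀) (+ p₁) (+ n₀) (+ n₁) ⟩
  (+ p₀ ℤ.- + n₀) ℤ.+ (+ p₁ ℤ.- + n₁)
    ≡⟨ cong₂ ℤ._+_ (points-balance (λ y → H (false ∷ y))) (points-balance (λ y → H (true ∷ y))) ⟩
  sumAll (λ x → sign (H x)) ∎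
  where
  open ≡-Reasoning
  H̄ : Input (suc _) → Bool
  H̄ x = not (H x)
  p₀ = length (points (λ y → H (false ∷ y)))
  p₁ = length (points (λ y → H (true ∷ y)))
  n₀ = length (points (λ y → H̄ (false ∷ y)))
  n₁ = length (points (λ y → H̄ (true ∷ y)))
  shuffle : ∀ a b c d → (a ℤ.+ b) ℤ.- (c ℤ.+ d) ≡ (a ℤ.- c) ℤ.+ (b ℤ.- d)
  shuffle = solve-∀

0<i-j⇒j<i : ∀ i j → + 0 ℤ.< i ℤ.- j → j ℤ.< i
0<i-j⇒j<i i j 0<i-j = subst₂ ℤ._<_ (ℤₚ.+-identityˡ j) (cancel i j) (ℤₚ.+-monoˡ-< j 0<i-j)
  where
  cancel : ∀ i j → (i ℤ.- j) ℤ.+ j ≡ i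
  cancel = solve-∀

-- With x₀ maximising ∣v∣ and D the largest degree in H: t ∣v x₀∣ = ∣A (A v) x₀∣ ≤ D² ∣v x₀∣.
degree-bound : ∀ {t} (H : Input t → Bool) (v : Input t → ℤ) →
               (∀ z → H z ≡ false → v z ≡ + 0) → (∀ z → H z ≡ false → A v z ≡ + 0) →
               ∀ x₁ → v x₁ ≢ + 0 → ∃ λ y → H y ≡ true × t ≤ degree H y ℕ.* degree H y
degree-bound {t} H v v-off Av-off x₁ vx₁≢0 = answer (H y₀) refl
  where
  x₀ = proj₁ (argmax (λ z → ℤ.∣ v z ∣))
  M = ℤ.∣ v x₀ ∣
  ∣v∣≤M : ∀ z → ℤ.∣ v z ∣ ≤ M
  ∣v∣≤M = proj₂ (argmax (λ z → ℤ.∣ v z ∣))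
  0<M : 0 < M
  0<M = ℕₚ.<-≤-trans (ℕₚ.n≢0⇒n>0 (vx₁≢0 ∘ ℤₚ.∣i∣≡0⇒i≡0)) (∣v∣≤M x₁)
  Hx₀ : H x₀ ≡ true
  Hx₀ with H x₀ in Hx₀
  ... | true  = refl
  ... | false = ⊥-elim (ℕₚ.<-irrefl (sym (cong ℤ.∣_∣ (v-off x₀ Hx₀))) 0<M)
  ψ : Input t → ℕ
  ψ y = if H y then degree H y else 0
  y₀ = proj₁ (argmax ψ)
  D = ψ y₀
  ψ≡ : ∀ y {b} → H y ≡ b → ψ y ≡ (if b then degree H y else 0)
  ψ≡ y = cong (λ b → if b then degree H y else 0)
  degree≤D : ∀ y → H y ≡ true → degree H y ≤ D
  degree≤D y Hy = subst (_≤ D) (ψ≡ y Hy) (proj₂ (argmax ψ) y)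
  ∣Av∣≤ : ∀ y → ℤ.∣ A v y ∣ ≤ ⟦ H y ⟧ ℕ.* (D ℕ.* M)
  ∣Av∣≤ y = ≤⟦⟧* (H y) _ (D ℕ.* M)
    (λ Hy → ℕₚ.≤-trans (∣A∣≤degree* H v M (λ z → ≤⟦⟧* (H z) _ M (λ _ → ∣v∣≤M z) (cong ℤ.∣_∣ ∘ v-off z)) y)
                       (ℕₚ.*-monoˡ-≤ M (degree≤D y Hy)))
    (cong ℤ.∣_∣ ∘ Av-off y)
  t*M≤D*D*M : t ℕ.* M ≤ (D ℕ.* D) ℕ.* M
  t*M≤D*D*M = begin
    t ℕ.* M                   ≡⟨ ℤₚ.abs-* (+ t) (v x₀) ⟨
    ℤ.∣ + t ℤ.* v x₀ ∣        ≡⟨ cong ℤ.∣_∣ (A²≡t* v x₀) ⟨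
    ℤ.∣ A (A v) x₀ ∣          ≤⟨ ∣A∣≤degree* H (A v) (D ℕ.* M) ∣Av∣≤ x₀ ⟩
    degree H x₀ ℕ.* (D ℕ.* M) ≤⟨ ℕₚ.*-monoˡ-≤ (D ℕ.* M) (degree≤D x₀ Hx₀) ⟩
    D ℕ.* (D ℕ.* M)           ≡⟨ ℕₚ.*-assoc D D M ⟨
    (D ℕ.* D) ℕ.* M           ∎
    where open ℕₚ.≤-Reasoning
  t≤D*D : t ≤ D ℕ.* D
  t≤D*D = ℕₚ.*-cancelʳ-≤ t (D ℕ.* D) M {{ℕ.>-nonZero 0<M}} t*M≤D*D*M
  answer : ∀ b → H y₀ ≡ b → ∃ λ y → H y ≡ true × t ≤ degree H y ℕ.* degree H y
  answer true  Hy₀ = y₀ , Hy₀ , subst (λ d → t ≤ d ℕ.* d) (ψ≡ y₀ Hy₀) t≤D*D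
  answer false Hy₀ = x₀ , Hx₀ , ℕₚ.≤-trans (subst (λ d → t ≤ d ℕ.* d) (ψ≡ y₀ Hy₀) t≤D*D) z≤n

huang : ∀ {t} (H : Input t → Bool) → + 0 ℤ.< sumAll (λ x → sign (H x)) →
        ∃ λ y → H y ≡ true × t ≤ degree H y ℕ.* degree H y
huang {t} H majority = degree-bound H v v-off Av-off witness v-witness≢0
  where
  xs = points H
  ys = points (λ x → not (H x))
  fewer : length ys < length xs
  fewer = ℤₚ.drop‿+<+ (0<i-j⇒j<i (+ length xs) (+ length ys)
                                   (subst (+ 0 ℤ.<_) (sym (points-balance H)) majority))
  _≟ᵥ_ : DecidableEquality (Input t)
  _≟ᵥ_ = Vecₚ.≡-dec Boolₚ._≟_
  open NontrivialSolution (nontrivialSolution _≟ᵥ_ (λ x → A (basis _≟ᵥ_ x)) xs ys (points-unique H) fewer)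
  v : Input t → ℤ
  v = lincomb coeff (basis _≟ᵥ_) xs
  v-off : ∀ z → H z ≡ false → v z ≡ + 0
  v-off z Hz = lincomb-basis-∉ _≟ᵥ_ coeff xs (λ z∈ → case (trans (sym (∈-points⁻ H z∈)) Hz))
    where
    case : true ≢ false
    case ()
  Av-off : ∀ z → H z ≡ false → A v z ≡ + 0
  Av-off z Hz = trans (A-lincomb coeff (basis _≟ᵥ_) xs z) (solves (∈-points⁺ (λ x → not (H x)) (cong not Hz)))
  v-witness≢0 : v witness ≢ + 0
  v-witness≢0 = coeff≢0 ∘ trans (sym (lincomb-basis-∈ _≟ᵥ_ coeff (points-unique H) witness∈))

-- Parity of the number of zeros rather than ones, so that the signed count of g xor parity is 2·∂⊤g.
oddZeros : ∀ {t} → Input t → Bool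
oddZeros []      = false
oddZeros (b ∷ x) = not b xor oddZeros x

oddZeros-flipBit : ∀ {t} (i : Fin t) x → oddZeros (flipBit i x) ≡ not (oddZeros x)
oddZeros-flipBit zero    (b ∷ x) = sym (Boolₚ.not-distribˡ-xor (not b) (oddZeros x))
oddZeros-flipBit (suc i) (b ∷ x) = trans (cong (not b xor_) (oddZeros-flipBit i x))
                                         (sym (Boolₚ.not-distribʳ-xor (not b) (oddZeros x)))

-- Flipping any bit flips oddZeros, so inside this set the neighbours of x are its sensitive neighbours for g.
twisted : ∀ {t} → Bool → (Input t → Bool) → Input t → Bool
twisted β g x = β xor (oddZeros x xor g x)

xor-flipped : ∀ β p a a′ → β xor (p xor a) ≡ true → β xor (not p xor a′) ≡ a xor a′
xor-flipped false false true  a′ _ = refl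
xor-flipped false true  false a′ _ = refl
xor-flipped true  false false a′ _ = Boolₚ.not-involutive a′
xor-flipped true  true  true  a′ _ = refl
xor-flipped false false false a′ ()
xor-flipped false true  true  a′ ()
xor-flipped true  false true  a′ ()
xor-flipped true  true  false a′ ()

twisted-flipBit : ∀ {t} β (g : Input t → Bool) i x → twisted β g x ≡ true →
                  twisted β g (flipBit i x) ≡ differs g i x
twisted-flipBit β g i x inside =
  trans (cong (λ p → β xor (p xor g (flipBit i x))) (oddZeros-flipBit i x))
        (xor-flipped β (oddZeros x) (g x) (g (flipBit i x)) inside)

foldr′-cong : ∀ {A B : Set} {n} {c c′ : A → B → B} → (∀ a r → c a r ≡ c′ a r) →
              ∀ z (xs : Vec A n) → foldr′ c z xs ≡ foldr′ c′ z xs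
foldr′-cong e z []       = refl
foldr′-cong {c = c} {c′} e z (x ∷ xs) = trans (cong (c x) (foldr′-cong e z xs)) (e x (foldr′ c′ z xs))

degree-twisted : ∀ {t} β (g : Input t → Bool) x → twisted β g x ≡ true → degree (twisted β g) x ≡ sensAt g x
degree-twisted β g x inside =
  foldr′-cong (λ i r → cong (λ b → ⟦ b ⟧ ℕ.+ r) (twisted-flipBit β g i x inside)) 0 (allFin _)

sign-not : ∀ b → sign (not b) ≡ ℤ.- sign b
sign-not true  = refl
sign-not false = refl

sumAll-neg : ∀ {n} (G : Input n → ℤ) → sumAll (λ x → ℤ.- G x) ≡ ℤ.- sumAll G
sumAll-neg {zero}  G = refl
sumAll-neg {suc n} G =
  trans (cong₂ ℤ._+_ (sumAll-neg (λ y → G (false ∷ y))) (sumAll-neg (λ y → G (true ∷ y))))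
        (sym (ℤₚ.neg-distrib-+ (sumAll (λ y → G (false ∷ y))) (sumAll (λ y → G (true ∷ y)))))

sumAll-sign-twisted-∷ : ∀ {t} (g : Input (suc t) → Bool) →
  sumAll (λ x → sign (twisted false g x)) ≡
  sumAll (λ y → sign (twisted false (λ z → g (true ∷ z)) y)) ℤ.- sumAll (λ y → sign (twisted false (λ z → g (false ∷ z)) y))
sumAll-sign-twisted-∷ g = trans
  (cong (ℤ._+ S₁) (trans (sumAll-cong (λ y → trans (cong sign (sym (Boolₚ.not-distribˡ-xor (oddZeros y) (g (false ∷ y)))))
                                                  (sign-not (oddZeros y xor g (false ∷ y)))))
                         (sumAll-neg (λ y → sign (oddZeros y xor g (false ∷ y))))))
  (ℤₚ.+-comm (ℤ.- S₀) S₁)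
  where
  S₀ = sumAll (λ y → sign (twisted false (λ z → g (false ∷ z)) y))
  S₁ = sumAll (λ y → sign (twisted false (λ z → g (true ∷ z)) y))

sumAll-sign-twisted : ∀ {t} (g : Input (suc t) → Bool) →
                      sumAll (λ x → sign (twisted false g x)) ≡ + 2 ℤ.* ∂ ⊤ (λ x → b2ℤ (g x)) 𝟎
sumAll-sign-twisted {zero} g =
  trans (sumAll-sign-twisted-∷ g) (base (g (false ∷ [])) (g (true ∷ [])))
  where
  base : ∀ a b → sign b ℤ.- sign a ≡ + 2 ℤ.* (b2ℤ b ℤ.- b2ℤ a)
  base false false = refl
  base false true  = refl
  base true  false = refl
  base true  true  = refl
sumAll-sign-twisted {suc t} g = begin
  sumAll (λ x → sign (twisted false g x))
    ≡⟨ sumAll-sign-twisted-∷ g ⟩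
  sumAll (λ y → sign (twisted false (λ z → g (true ∷ z)) y)) ℤ.- sumAll (λ y → sign (twisted false (λ z → g (false ∷ z)) y))
    ≡⟨ cong₂ ℤ._-_ (sumAll-sign-twisted (λ z → g (true ∷ z))) (sumAll-sign-twisted (λ z → g (false ∷ z))) ⟩
  + 2 ℤ.* ∂₁ ℤ.- + 2 ℤ.* ∂₀
    ≡⟨ distrib ∂₁ ∂₀ ⟩
  + 2 ℤ.* (∂₁ ℤ.- ∂₀) ∎
  where
  open ≡-Reasoning
  ∂₀ = ∂ ⊤ (λ x → b2ℤ (g (false ∷ x))) 𝟎
  ∂₁ = ∂ ⊤ (λ x → b2ℤ (g (true ∷ x))) 𝟎
  distrib : ∀ a b → + 2 ℤ.* a ℤ.- + 2 ℤ.* b ≡ + 2 ℤ.* (a ℤ.- b)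
  distrib = solve-∀

twisted-majority : ∀ {t} (g : Input (suc t) → Bool) → ∂ ⊤ (λ x → b2ℤ (g x)) 𝟎 ≢ + 0 →
                   ∃ λ β → + 0 ℤ.< sumAll (λ x → sign (twisted β g x))
twisted-majority g ∂≢0 with ℤₚ.<-cmp (+ 0) (sumAll (λ x → sign (twisted false g x)))
... | tri< 0<S _ _ = false , 0<S
... | tri≈ _ 0≡S _ with ℤₚ.i*j≡0⇒i≡0∨j≡0 (+ 2) (trans (sym (sumAll-sign-twisted g)) (sym 0≡S))
...   | inj₁ ()
...   | inj₂ ∂≡0 = ⊥-elim (∂≢0 ∂≡0)
twisted-majority g ∂≢0 | tri> _ _ S<0 =
  true , subst (+ 0 ℤ.<_) (sym (trans (sumAll-cong (λ x → sign-not (twisted false g x)))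
                                      (sumAll-neg (λ x → sign (twisted false g x)))))
               (ℤₚ.neg-mono-< S<0)

sensitive-point : ∀ {t} (g : Input t → Bool) → 0 < t → ∂ ⊤ (λ x → b2ℤ (g x)) 𝟎 ≢ + 0 →
                  ∃₂ λ y j → differs g j y ≡ true × t ≤ sensAt g y ℕ.* sensAt g y
sensitive-point {suc t} g _ ∂≢0 =
  let β , majority   = twisted-majority g ∂≢0
      y , inside , t≤d² = huang (twisted β g) majority
      t≤s² = subst (λ d → suc t ≤ d ℕ.* d) (degree-twisted β g y inside) t≤d²
      j , dj = 0<sensAt⇒differs g y (positive (sensAt g y) t≤s²)
  in y , j , dj , t≤s²
  where
  positive : ∀ s → suc t ≤ s ℕ.* s → 0 < s
  positive (suc s) _ = s≤s z≤n

sensAt<sens : ∀ {n} (f : BoolFun n) i x → differs f i x ≡ true → sensAt f x < sens f i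
sensAt<sens f i x d = ℕₚ.≤-trans
  (subst (_≤ sensAt f x ℕ.+ sensAt f (flipBit i x)) (ℕₚ.+-comm (sensAt f x) 1)
         (ℕₚ.+-monoʳ-≤ (sensAt f x) (differs⇒0<sensAt f i (flipBit i x) (trans (differs-flipBit f i x) d))))
  (sensAt+sensAt≤sens f i x d)

-- Restrict f to a subcube in the directions T on which its T-th derivative survives, and apply Huang.
sensitive-coordinate : ∀ {n} (f : BoolFun n) {M T} → ∂ M (λ x → b2ℤ (f x)) 𝟎 ≢ + 0 → T ⊆ M → 0 < ∣ T ∣ →
                       ∃₂ λ i D → i ∈ T × ∣ T ∣ ≤ D ℕ.* D × D < sens f i
sensitive-coordinate f {M} {T} ∂M≢0 T⊆M 0<∣T∣ =
  let w , ∂T≢0 = ∂-nonzero-⊆ T⊆M (λ x → b2ℤ (f x)) 𝟎 ∂M≢0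
      y , j , dj , ∣T∣≤D² = sensitive-point (f ∘ embed T w) 0<∣T∣
                                            (∂T≢0 ∘ trans (∂-embed T (λ x → b2ℤ (f x)) w))
      i = position T j
  in i , sensAt (f ∘ embed T w) y , position-∈ T j , ∣T∣≤D²
     , ℕₚ.≤-<-trans (sensAt-embed f T w y)
                    (sensAt<sens f i (embed T w y) (trans (differs-embed f T w y j) dj))

select : ∀ {A : Set} {m} → (A → Bool) → (A → ℕ) → Vec A m → List ℕ
select p s []       = []
select p s (i ∷ is) = if p i then s i ∷ select p s is else select p s is

weight : List ℕ → ℚ
weight L = List.foldr ℚ._+_ 0ℚ (List.map inv2^ L)

foldr′-select : ∀ {A : Set} {m} (p : A → Bool) (s : A → ℕ) (q : A → ℚ) →
                (∀ i → q i ≡ (if p i then inv2^ (s i) else 0ℚ)) →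
                ∀ (is : Vec A m) → foldr′ (λ i acc → q i ℚ.+ acc) 0ℚ is ≡ weight (select p s is)
foldr′-select p s q q≡ []       = refl
foldr′-select p s q q≡ (i ∷ is) with p i in pi
... | true  = cong₂ ℚ._+_ (trans (q≡ i) (cong (λ b → if b then inv2^ (s i) else 0ℚ) pi))
                          (foldr′-select p s q q≡ is)
... | false = trans (cong₂ ℚ._+_ (trans (q≡ i) (cong (λ b → if b then inv2^ (s i) else 0ℚ) pi))
                                 (foldr′-select p s q q≡ is))
                    (ℚₚ.+-identityˡ _)

length-filter-select : ∀ {A : Set} {m} (p : A → Bool) (s : A → ℕ) k (is : Vec A m) →
                       length (List.filterᵇ (ℕ._≤ᵇ k) (select p s is)) ≡ ∣ map (λ i → p i ∧ (s i ℕ.≤ᵇ k)) is ∣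
length-filter-select p s k []       = refl
length-filter-select p s k (i ∷ is) with p i
... | false = length-filter-select p s k is
... | true with s i ℕ.≤ᵇ k
...   | true  = cong suc (length-filter-select p s k is)
...   | false = length-filter-select p s k is

length-select : ∀ {A : Set} {m} (p p′ : A → Bool) (s : A → ℕ) → (∀ i → p i ≡ true → p′ i ≡ true) →
                ∀ (is : Vec A m) → length (select p s is) ≤ ∣ map p′ is ∣
length-select p p′ s p⇒p′ []       = z≤n
length-select p p′ s p⇒p′ (i ∷ is) with p i in pi | p′ i in p′i
... | true  | true  = s≤s (length-select p p′ s p⇒p′ is)
... | true  | false = ⊥-elim (case (trans (sym (p⇒p′ i pi)) p′i))
  where
  case : true ≢ false
  case ()
... | false | true  = ℕₚ.m≤n⇒m≤1+n (length-select p p′ s p⇒p′ is)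
... | false | false = length-select p p′ s p⇒p′ is

selected : ∀ {n} → BoolFun n → Subset n → Fin n → Bool
selected f M i = lookup M i ∧ anyAll (differs f i)

exponents : ∀ {n} → BoolFun n → Subset n → List ℕ
exponents {n} f M = select (selected f M) (sens f) (allFin n)

lhs≡weight : ∀ {n} (f : BoolFun n) M → lhs f M ≡ weight (exponents f M)
lhs≡weight {n} f M = foldr′-select (selected f M) (sens f) _ term (allFin n)
  where
  term : ∀ i → (if lookup M i then δ f i /2^ sens f i else 0ℚ) ≡ (if selected f M i then inv2^ (sens f i) else 0ℚ)
  term i with lookup M i
  ... | false = refl
  ... | true with anyAll (differs f i)
  ...   | true  = ℚₚ.*-identityˡ (inv2^ (sens f i))
  ...   | false = ℚₚ.*-zeroˡ (inv2^ (sens f i))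

∧-true : ∀ {a b} → a ∧ b ≡ true → a ≡ true × b ≡ true
∧-true {true} {true} _ = refl , refl

∈-map-allFin : ∀ {n} (q : Fin n → Bool) {i} → i ∈ map q (allFin n) → q i ≡ true
∈-map-allFin q {i} i∈ =
  trans (sym (trans (Vecₚ.lookup-map i q (allFin _)) (cong q (Vecₚ.lookup-allFin i)))) (Vecₚ.[]=⇒lookup i∈)

length-exponents : ∀ {n} (f : BoolFun n) M → length (exponents f M) ≤ ∣ M ∣
length-exponents {n} f M = subst (length (exponents f M) ≤_) (cong ∣_∣ (Vecₚ.map-lookup-allFin M))
  (length-select (selected f M) (lookup M) (sens f) (λ i → proj₁ ∘ ∧-true) (allFin n))

exponents-count : ∀ {n} (f : BoolFun n) {M} → ∂ M (λ x → b2ℤ (f x)) 𝟎 ≢ + 0 →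
                  ∀ k → length (List.filterᵇ (ℕ._≤ᵇ k) (exponents f M)) ≤ (k ∸ 1) ℕ.* (k ∸ 1)
exponents-count {n} f {M} ∂M≢0 k =
  subst (_≤ (k ∸ 1) ℕ.* (k ∸ 1)) (sym (length-filter-select (selected f M) (sens f) k (allFin n)))
        (∣S∣≤ ∣ S ∣ refl)
  where
  S : Subset n
  S = map (λ i → selected f M i ∧ (sens f i ℕ.≤ᵇ k)) (allFin n)
  S⊆M : S ⊆ M
  S⊆M {i} i∈S = Vecₚ.lookup⇒[]= i M (proj₁ (∧-true (proj₁ (∧-true (∈-map-allFin _ i∈S)))))
  ∣S∣≤ : ∀ m → ∣ S ∣ ≡ m → m ≤ (k ∸ 1) ℕ.* (k ∸ 1)
  ∣S∣≤ zero    _     = z≤n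
  ∣S∣≤ (suc m) ∣S∣≡ =
    let i , D , i∈S , ∣S∣≤D² , D<sens = sensitive-coordinate f ∂M≢0 S⊆M (subst (0 <_) (sym ∣S∣≡) (s≤s z≤n))
        sens≤k = ℕₚ.≤ᵇ⇒≤ (sens f i) k (subst T (sym (proj₂ (∧-true (∈-map-allFin _ i∈S)))) _)
        D≤k-1 = ℕₚ.∸-monoˡ-≤ 1 (ℕₚ.<-≤-trans D<sens sens≤k)
    in subst (_≤ (k ∸ 1) ℕ.* (k ∸ 1)) ∣S∣≡ (ℕₚ.≤-trans ∣S∣≤D² (ℕₚ.*-mono-≤ D≤k-1 D≤k-1))

inv2^-positive : ∀ k → 0ℚ ℚ.< inv2^ k
inv2^-positive zero    = ℚₚ.positive⁻¹ 1ℚ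
inv2^-positive (suc k) = ℚₚ.positive⁻¹ (½ ℚ.* inv2^ k) {{ℚₚ.pos*pos⇒pos ½ (inv2^ k) {{ℚ.positive (inv2^-positive k)}}}}

inv2^-halves : ∀ k → inv2^ k ≡ inv2^ (suc k) ℚ.+ inv2^ (suc k)
inv2^-halves k = sym (trans (sym (ℚₚ.*-distribʳ-+ (inv2^ k) ½ ½)) (ℚₚ.*-identityˡ (inv2^ k)))

inv2^-antitone : ∀ {k m} → k ≤ m → inv2^ m ℚ.≤ inv2^ k
inv2^-antitone = go ∘ ℕₚ.≤⇒≤′
  where
  go : ∀ {k m} → k ℕ.≤′ m → inv2^ m ℚ.≤ inv2^ k
  go ℕ.≤′-refl                  = ℚₚ.≤-refl
  go {k} (ℕ.≤′-step {m} k≤′m) = ℚₚ.≤-trans (ℚₚ.<⇒≤ half<) (go k≤′m)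
    where
    half< : inv2^ (suc m) ℚ.< inv2^ m
    half< = subst₂ ℚ._<_ (ℚₚ.+-identityˡ (inv2^ (suc m))) (sym (inv2^-halves m))
                   (ℚₚ.+-monoˡ-< (inv2^ (suc m)) (inv2^-positive (suc m)))

toℚᵘ-/1 : ∀ a → ℚ.toℚᵘ (+ a / 1) ℚᵘ.≃ ℚᵘ.mkℚᵘ (+ a) 0
toℚᵘ-/1 a = ℚₚ.toℚᵘ-fromℚᵘ (ℚᵘ.mkℚᵘ (+ a) 0)

/1-+ : ∀ a b → + (a ℕ.+ b) / 1 ≡ + a / 1 ℚ.+ + b / 1
/1-+ a b = ℚₚ.toℚᵘ-injective (ℚᵘₚ.≃-trans (toℚᵘ-/1 (a ℕ.+ b))
  (ℚᵘₚ.≃-sym (ℚᵘₚ.≃-trans (ℚₚ.toℚᵘ-homo-+ (+ a / 1) (+ b / 1))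
    (ℚᵘₚ.≃-trans (ℚᵘₚ.+-cong (toℚᵘ-/1 a) (toℚᵘ-/1 b))
      (ℚᵘ.*≡* (trans (units (+ a) (+ b)) (cong (ℤ._* (+ 1 ℤ.* + 1)) (sym (ℤₚ.pos-+ a b)))))))))
  where
  units : ∀ a b → (a ℤ.* + 1 ℤ.+ b ℤ.* + 1) ℤ.* + 1 ≡ (a ℤ.+ b) ℤ.* (+ 1 ℤ.* + 1)
  units = solve-∀

/1-mono-≤ : ∀ {a b} → a ≤ b → + a / 1 ℚ.≤ + b / 1
/1-mono-≤ {a} {b} a≤b = ℚₚ.toℚᵘ-cancel-≤
  (ℚᵘₚ.≤-respˡ-≃ (ℚᵘₚ.≃-sym (toℚᵘ-/1 a)) (ℚᵘₚ.≤-respʳ-≃ (ℚᵘₚ.≃-sym (toℚᵘ-/1 b))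
    (ℚᵘ.*≤* (subst₂ ℤ._≤_ (sym (ℤₚ.*-identityʳ (+ a))) (sym (ℤₚ.*-identityʳ (+ b))) (ℤ.+≤+ a≤b)))))

/2^-+ : ∀ a b k → (a ℕ.+ b) /2^ k ≡ a /2^ k ℚ.+ b /2^ k
/2^-+ a b k = trans (cong (ℚ._* inv2^ k) (/1-+ a b)) (ℚₚ.*-distribʳ-+ (inv2^ k) (+ a / 1) (+ b / 1))

/2^-double : ∀ a k → a /2^ k ≡ (a ℕ.+ a) /2^ suc k
/2^-double a k = begin
  (+ a / 1) ℚ.* inv2^ k                                  ≡⟨ cong ((+ a / 1) ℚ.*_) (inv2^-halves k) ⟩
  (+ a / 1) ℚ.* (inv2^ (suc k) ℚ.+ inv2^ (suc k))        ≡⟨ ℚₚ.*-distribˡ-+ (+ a / 1) (inv2^ (suc k)) (inv2^ (suc k)) ⟩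
  a /2^ suc k ℚ.+ a /2^ suc k                            ≡⟨ /2^-+ a a (suc k) ⟨
  (a ℕ.+ a) /2^ suc k ∎
  where open ≡-Reasoning

/2^-monoˡ-≤ : ∀ {a b} k → a ≤ b → a /2^ k ℚ.≤ b /2^ k
/2^-monoˡ-≤ k a≤b = ℚₚ.*-monoʳ-≤-nonNeg (inv2^ k) {{ℚ.nonNegative (ℚₚ.<⇒≤ (inv2^-positive k))}} (/1-mono-≤ a≤b)

-- Integer square roots and the bound

isqrt-step : ∀ d → d < suc (isqrt d) ℕ.* suc (isqrt d) →
             (isqrt (suc d) ≡ suc (isqrt d) × suc d ≡ suc (isqrt d) ℕ.* suc (isqrt d))
           ⊎ (isqrt (suc d) ≡ isqrt d × suc d < suc (isqrt d) ℕ.* suc (isqrt d))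
isqrt-step d d<[r+1]² with suc (isqrt d) ℕ.* suc (isqrt d) ℕ.≤ᵇ suc d in e
... | true  = inj₁ (refl , ℕₚ.≤-antisym d<[r+1]² (ℕₚ.≤ᵇ⇒≤ _ _ (subst T (sym e) _)))
... | false = inj₂ (refl , ℕₚ.≰⇒> (λ [r+1]²≤ → subst T e (ℕₚ.≤⇒≤ᵇ [r+1]²≤)))

isqrt-spec : ∀ d → isqrt d ℕ.* isqrt d ≤ d × d < suc (isqrt d) ℕ.* suc (isqrt d)
isqrt-spec zero    = z≤n , s≤s z≤n
isqrt-spec (suc d) with isqrt-step d (proj₂ (isqrt-spec d))
... | inj₁ (r′≡ , square) rewrite r′≡ =
  ℕₚ.≤-reflexive (sym square) , subst (_< suc (suc (isqrt d)) ℕ.* suc (suc (isqrt d))) (sym square)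
                                      (ℕₚ.*-mono-< (ℕₚ.n<1+n (suc (isqrt d))) (ℕₚ.n<1+n (suc (isqrt d))))
... | inj₂ (r′≡ , below) rewrite r′≡ = ℕₚ.m≤n⇒m≤1+n (proj₁ (isqrt-spec d)) , below

isqrt< : ∀ {d c} → d < c ℕ.* c → isqrt d < c
isqrt< {d} {c} d<c² = ℕₚ.≰⇒> λ c≤r → ℕₚ.<-irrefl refl
  (ℕₚ.<-≤-trans d<c² (ℕₚ.≤-trans (ℕₚ.*-mono-≤ c≤r c≤r) (proj₁ (isqrt-spec d))))

partialSum : ℕ → ℚ
partialSum m = sumFromTo 2 (suc m) (λ k → (2 ℕ.* k ∸ 3) /2^ k)

partialSum-suc : ∀ m → partialSum (suc m) ≡ partialSum m ℚ.+ suc (2 ℕ.* m) /2^ (2 ℕ.+ m)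
partialSum-suc m = cong (λ a → partialSum m ℚ.+ (a ∸ 3) /2^ (2 ℕ.+ m)) (double m)
  where
  double : ∀ m → 2 ℕ.* (2 ℕ.+ m) ≡ 4 ℕ.+ 2 ℕ.* m
  double = NatSolver.solve-∀

partialSum-closed : ∀ m → partialSum m ℚ.+ (2 ℕ.* m ℕ.+ 3) /2^ suc m ≡ + 3 / 2
partialSum-closed zero    = refl
partialSum-closed (suc m) = begin
  partialSum (suc m) ℚ.+ (2 ℕ.* suc m ℕ.+ 3) /2^ (2 ℕ.+ m)
    ≡⟨ cong (ℚ._+ (2 ℕ.* suc m ℕ.+ 3) /2^ (2 ℕ.+ m)) (partialSum-suc m) ⟩
  (partialSum m ℚ.+ suc (2 ℕ.* m) /2^ (2 ℕ.+ m)) ℚ.+ (2 ℕ.* suc m ℕ.+ 3) /2^ (2 ℕ.+ m)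
    ≡⟨ ℚₚ.+-assoc (partialSum m) _ _ ⟩
  partialSum m ℚ.+ (suc (2 ℕ.* m) /2^ (2 ℕ.+ m) ℚ.+ (2 ℕ.* suc m ℕ.+ 3) /2^ (2 ℕ.+ m))
    ≡⟨ cong (partialSum m ℚ.+_) (sym (/2^-+ (suc (2 ℕ.* m)) (2 ℕ.* suc m ℕ.+ 3) (2 ℕ.+ m))) ⟩
  partialSum m ℚ.+ (suc (2 ℕ.* m) ℕ.+ (2 ℕ.* suc m ℕ.+ 3)) /2^ (2 ℕ.+ m)
    ≡⟨ cong (λ a → partialSum m ℚ.+ a /2^ (2 ℕ.+ m)) (regroup m) ⟩
  partialSum m ℚ.+ ((2 ℕ.* m ℕ.+ 3) ℕ.+ (2 ℕ.* m ℕ.+ 3)) /2^ (2 ℕ.+ m)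
    ≡⟨ cong (partialSum m ℚ.+_) (sym (/2^-double (2 ℕ.* m ℕ.+ 3) (suc m))) ⟩
  partialSum m ℚ.+ (2 ℕ.* m ℕ.+ 3) /2^ suc m
    ≡⟨ partialSum-closed m ⟩
  + 3 / 2 ∎
  where
  open ≡-Reasoning
  regroup : ∀ m → suc (2 ℕ.* m) ℕ.+ (2 ℕ.* suc m ℕ.+ 3) ≡ (2 ℕ.* m ℕ.+ 3) ℕ.+ (2 ℕ.* m ℕ.+ 3)
  regroup = NatSolver.solve-∀

boundAt : ℕ → ℕ → ℚ
boundAt d r = partialSum r ℚ.+ (d ∸ r ℕ.* r) /2^ (2 ℕ.+ r)

excess : ∀ r d → suc d ≡ suc r ℕ.* suc r → d ∸ r ℕ.* r ≡ 2 ℕ.* r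
excess r d square = trans (cong (_∸ r ℕ.* r) d≡) (ℕₚ.m+n∸n≡m (2 ℕ.* r) (r ℕ.* r))
  where
  expand : ∀ r → suc r ℕ.* suc r ≡ suc (2 ℕ.* r ℕ.+ r ℕ.* r)
  expand = NatSolver.solve-∀
  d≡ : d ≡ 2 ℕ.* r ℕ.+ r ℕ.* r
  d≡ = ℕₚ.suc-injective (trans square (expand r))

/2^-1+ : ∀ S x k → S ℚ.+ (1 ℕ.+ x) /2^ k ≡ inv2^ k ℚ.+ (S ℚ.+ x /2^ k)
/2^-1+ S x k = begin
  S ℚ.+ (1 ℕ.+ x) /2^ k           ≡⟨ cong (S ℚ.+_) (trans (/2^-+ 1 x k) (cong (ℚ._+ x /2^ k) (ℚₚ.*-identityˡ (inv2^ k)))) ⟩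
  S ℚ.+ (inv2^ k ℚ.+ x /2^ k)     ≡⟨ ℚₚ.+-assoc S (inv2^ k) (x /2^ k) ⟨
  (S ℚ.+ inv2^ k) ℚ.+ x /2^ k     ≡⟨ cong (ℚ._+ x /2^ k) (ℚₚ.+-comm S (inv2^ k)) ⟩
  (inv2^ k ℚ.+ S) ℚ.+ x /2^ k     ≡⟨ ℚₚ.+-assoc (inv2^ k) S (x /2^ k) ⟩
  inv2^ k ℚ.+ (S ℚ.+ x /2^ k) ∎
  where open ≡-Reasoning

bound-suc : ∀ d → bound (suc d) ≡ inv2^ (2 ℕ.+ isqrt d) ℚ.+ bound d
bound-suc d with isqrt-step d (proj₂ (isqrt-spec d))
... | inj₁ (r′≡ , square) = begin
  boundAt (suc d) (isqrt (suc d))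
    ≡⟨ cong (boundAt (suc d)) r′≡ ⟩
  partialSum (suc r) ℚ.+ (suc d ∸ suc r ℕ.* suc r) /2^ (3 ℕ.+ r)
    ≡⟨ cong₂ (λ s a → s ℚ.+ a /2^ (3 ℕ.+ r)) (partialSum-suc r) (ℕₚ.m≤n⇒m∸n≡0 (ℕₚ.≤-reflexive square)) ⟩
  (partialSum r ℚ.+ suc (2 ℕ.* r) /2^ (2 ℕ.+ r)) ℚ.+ 0 /2^ (3 ℕ.+ r)
    ≡⟨ trans (cong ((partialSum r ℚ.+ suc (2 ℕ.* r) /2^ (2 ℕ.+ r)) ℚ.+_) (ℚₚ.*-zeroˡ (inv2^ (3 ℕ.+ r))))
             (ℚₚ.+-identityʳ _) ⟩
  partialSum r ℚ.+ (1 ℕ.+ 2 ℕ.* r) /2^ (2 ℕ.+ r)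
    ≡⟨ cong (λ a → partialSum r ℚ.+ (1 ℕ.+ a) /2^ (2 ℕ.+ r)) (sym (excess r d square)) ⟩
  partialSum r ℚ.+ (1 ℕ.+ (d ∸ r ℕ.* r)) /2^ (2 ℕ.+ r)
    ≡⟨ /2^-1+ (partialSum r) (d ∸ r ℕ.* r) (2 ℕ.+ r) ⟩
  inv2^ (2 ℕ.+ r) ℚ.+ bound d ∎
  where
  open ≡-Reasoning
  r = isqrt d
... | inj₂ (r′≡ , _) = begin
  boundAt (suc d) (isqrt (suc d))
    ≡⟨ cong (boundAt (suc d)) r′≡ ⟩
  partialSum r ℚ.+ (suc d ∸ r ℕ.* r) /2^ (2 ℕ.+ r)
    ≡⟨ cong (λ a → partialSum r ℚ.+ a /2^ (2 ℕ.+ r)) (ℕₚ.+-∸-assoc 1 (proj₁ (isqrt-spec d))) ⟩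
  partialSum r ℚ.+ (1 ℕ.+ (d ∸ r ℕ.* r)) /2^ (2 ℕ.+ r)
    ≡⟨ /2^-1+ (partialSum r) (d ∸ r ℕ.* r) (2 ℕ.+ r) ⟩
  inv2^ (2 ℕ.+ r) ℚ.+ bound d ∎
  where
  open ≡-Reasoning
  r = isqrt d

/2^-monoˡ-< : ∀ {a b} k → a < b → a /2^ k ℚ.< b /2^ k
/2^-monoˡ-< {a} k a<b = ℚₚ.<-≤-trans a<1+a (/2^-monoˡ-≤ k a<b)
  where
  a<1+a : a /2^ k ℚ.< suc a /2^ k
  a<1+a = subst₂ ℚ._<_ (ℚₚ.+-identityˡ (a /2^ k))
                 (sym (trans (/2^-+ 1 a k) (cong (ℚ._+ a /2^ k) (ℚₚ.*-identityˡ (inv2^ k)))))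
                 (ℚₚ.+-monoˡ-< (a /2^ k) (inv2^-positive k))

bound<3/2 : ∀ d → bound d ℚ.< + 3 / 2
bound<3/2 d = subst (bound d ℚ.<_) (partialSum-closed r)
  (ℚₚ.+-monoʳ-< (partialSum r)
    (subst (x /2^ (2 ℕ.+ r) ℚ.<_) (sym (/2^-double (2 ℕ.* r ℕ.+ 3) (suc r)))
           (/2^-monoˡ-< (2 ℕ.+ r) (ℕₚ.≤-<-trans x≤2r 2r<))))
  where
  r = isqrt d
  x = d ∸ r ℕ.* r
  expand : ∀ r → suc r ℕ.* suc r ≡ suc (2 ℕ.* r ℕ.+ r ℕ.* r)
  expand = NatSolver.solve-∀
  x≤2r : x ≤ 2 ℕ.* r
  x≤2r = subst (x ≤_) (ℕₚ.m+n∸n≡m (2 ℕ.* r) (r ℕ.* r))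
               (ℕₚ.∸-monoˡ-≤ (r ℕ.* r) (ℕₚ.≤-pred (subst (d <_) (expand r) (proj₂ (isqrt-spec d)))))
  2r< : 2 ℕ.* r < (2 ℕ.* r ℕ.+ 3) ℕ.+ (2 ℕ.* r ℕ.+ 3)
  2r< = ℕₚ.<-≤-trans (ℕₚ.m<m+n (2 ℕ.* r) (s≤s z≤n)) (ℕₚ.m≤m+n (2 ℕ.* r ℕ.+ 3) (2 ℕ.* r ℕ.+ 3))

-- Σ_{j<d} 2^-(2+⌊√j⌋), the weight of the extremal exponent list.
maxWeight : ℕ → ℚ
maxWeight zero    = 0ℚ
maxWeight (suc d) = inv2^ (2 ℕ.+ isqrt d) ℚ.+ maxWeight d

maxWeight≡bound : ∀ d → maxWeight d ≡ bound d
maxWeight≡bound zero    = refl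
maxWeight≡bound (suc d) = trans (cong (inv2^ (2 ℕ.+ isqrt d) ℚ.+_) (maxWeight≡bound d)) (sym (bound-suc d))

maxWeight-mono : ∀ {l m} → l ≤ m → maxWeight l ℚ.≤ maxWeight m
maxWeight-mono = go ∘ ℕₚ.≤⇒≤′
  where
  go : ∀ {l m} → l ℕ.≤′ m → maxWeight l ℚ.≤ maxWeight m
  go ℕ.≤′-refl                  = ℚₚ.≤-refl
  go {l} (ℕ.≤′-step {m} l≤′m) = ℚₚ.≤-trans (go l≤′m)
    (subst (ℚ._≤ maxWeight (suc m)) (ℚₚ.+-identityˡ (maxWeight m))
           (ℚₚ.+-monoˡ-≤ (maxWeight m) (ℚₚ.<⇒≤ (inv2^-positive (2 ℕ.+ isqrt m)))))

weight-↭ : ∀ {L L′} → L ↭ L′ → weight L ≡ weight L′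
weight-↭ L↭L′ = Permₛₚ.foldr-commMonoid ℚₚ.+-0-isCommutativeMonoid (↭⇒↭ₛ (Permₚ.map⁺ inv2^ L↭L′))

length-filterᵇ-↭ : ∀ (q : ℕ → Bool) {L L′} → L ↭ L′ → length (List.filterᵇ q L) ≡ length (List.filterᵇ q L′)
length-filterᵇ-↭ q = Permₚ.↭-length ∘ Permₚ.filter-↭ (T? ∘ q)

length-filterᵇ-∷ : ∀ (q : ℕ → Bool) s L → length (List.filterᵇ q L) ≤ length (List.filterᵇ q (s ∷ L))
length-filterᵇ-∷ q s L with q s
... | true  = ℕₚ.n≤1+n _
... | false = ℕₚ.≤-refl

-- The largest exponent s of a list of length d+1 has s ≥ 2 + ⌊√d⌋, and then induct.
weight-descending : ∀ L → Linked ℕ._≥_ L → (∀ k → length (List.filterᵇ (ℕ._≤ᵇ k) L) ≤ (k ∸ 1) ℕ.* (k ∸ 1)) →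
                    weight L ℚ.≤ maxWeight (length L)
weight-descending []      _      _      = ℚₚ.≤-refl
weight-descending (s ∷ L) sorted count≤ =
  ℚₚ.+-mono-≤ (inv2^-antitone (largest s count-at-s))
              (weight-descending L (Linked.tail sorted) (λ k → ℕₚ.≤-trans (length-filterᵇ-∷ (ℕ._≤ᵇ k) s L) (count≤ k)))
  where
  all≤s : All.All (λ x → T (x ℕ.≤ᵇ s)) (s ∷ L)
  all≤s = All.map ℕₚ.≤⇒≤ᵇ (Linked⇒All (λ x≥y y≥z → ℕₚ.≤-trans y≥z x≥y) ℕₚ.≤-refl sorted)
  count-at-s : suc (length L) ≤ (s ∸ 1) ℕ.* (s ∸ 1)
  count-at-s = subst (_≤ (s ∸ 1) ℕ.* (s ∸ 1)) (cong length (Listₚ.filter-all (T? ∘ (ℕ._≤ᵇ s)) all≤s)) (count≤ s)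
  largest : ∀ s → suc (length L) ≤ (s ∸ 1) ℕ.* (s ∸ 1) → 2 ℕ.+ isqrt (length L) ≤ s
  largest (suc s) d<s² = s≤s (isqrt< d<s²)

weight≤maxWeight : ∀ L → (∀ k → length (List.filterᵇ (ℕ._≤ᵇ k) L) ≤ (k ∸ 1) ℕ.* (k ∸ 1)) →
                   weight L ℚ.≤ maxWeight (length L)
weight≤maxWeight L count≤ = subst₂ (λ w l → w ℚ.≤ maxWeight l) (weight-↭ sorted↭L) (Permₚ.↭-length sorted↭L)
  (weight-descending (Descending.sort L) (Descending.sort-↗ L)
     (λ k → subst (_≤ (k ∸ 1) ℕ.* (k ∸ 1)) (sym (length-filterᵇ-↭ (ℕ._≤ᵇ k) sorted↭L)) (count≤ k)))
  where
  sorted↭L = Descending.sort-↭ L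

corollary3 : (n : ℕ) (f : BoolFun n) (M : Vec Bool n) →
    1 ≤ ∣ M ∣ →
    Σ (Vec Bool n → ℤ) (λ c → Represents c f × c M ≢ + 0) →
    (lhs f M ≤ℚ bound ∣ M ∣) × (bound ∣ M ∣ <ℚ (+ 3 / 2))
corollary3 n f M _ (c , rep , cM≢0) = lhs≤bound , bound<3/2 ∣ M ∣
  where
  ∂M≢0 : ∂ M (λ x → b2ℤ (f x)) 𝟎 ≢ + 0
  ∂M≢0 = cM≢0 ∘ trans (coefficient≡∂ c rep M)
  lhs≤bound : lhs f M ≤ℚ bound ∣ M ∣
  lhs≤bound = begin
    lhs f M                            ≡⟨ lhs≡weight f M ⟩
    weight (exponents f M)             ≤⟨ weight≤maxWeight (exponents f M) (exponents-count f {M} ∂M≢0) ⟩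
    maxWeight (length (exponents f M)) ≤⟨ maxWeight-mono (length-exponents f M) ⟩
    maxWeight ∣ M ∣                    ≡⟨ maxWeight≡bound ∣ M ∣ ⟩
    bound ∣ M ∣                        ∎
    where open ℚₚ.≤-Reasoning
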